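{- Let $\Gamma$ be a distance-regular graph with valency $k\ge 2$, diameter $D\ge 2$ and smallest eigenvalue $\theta_{\min}$. If $\theta_{\min}\le -k/2$ and $a_1\ge 2$, then $\Gamma$ is a complete tripartite graph $K_{t,t,t}$ for some $t\ge 2$.
   Context: A connected graph $\Gamma$ of diameter $D$ is distance-regular if there are integers $b_i,c_i$ ($0\le i\le D$) such that for any two vertices $x,y$ at distance $i$, $y$ has exactly $c_i$ neighbours at distance $i-1$ from $x$ and $b_i$ neighbours at distance $i+1$ from $x$; $k=b_0$ and $a_i=k-b_i-c_i$ (so $a_1$ is the number of common neighbours of two adjacent vertices). Eigenvalues are those of the adjacency matrix. -}

module Defs where

open import Level using (Level; _⊔_) renaming (suc to lsuc)
open import Data.Bool using (Bool; true; false; _∧_; _∨_; not; if_then_else_)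
open import Data.Nat as ℕ using (ℕ; zero; suc; _∸_)
open import Data.Fin using (Fin; _≟_)
open import Data.Fin.Properties using ()
open import Data.Nat.ListAction using (sum)
open import Data.Bool.ListAction using (any)
open import Data.List using (List; []; _∷_; allFin; map; foldr; length; _++_; [_])
open import Data.Product using (Σ; ∃; _×_; _,_)
open import Relation.Nullary using (¬_; does)
open import Relation.Binary using (Rel; IsTotalOrder)
open import Relation.Binary.PropositionalEquality using (_≡_)
open import Algebra.Structures using (IsCommutativeRing)
open import Function.Bundles using (_⤖_; Bijection)

-- Real closed fields (used as a stand-in for ℝ, which agda-stdlib lacks)

horner : ∀ {c} {A : Set c} → (A → A → A) → (A → A → A) → A → List A → A → A
horner _+_ _*_ 0# []       x = 0#
horner _+_ _*_ 0# (a ∷ as) x = a + (x * horner _+_ _*_ 0# as x)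

record RealClosedField c ℓ₁ ℓ₂ : Set (lsuc (c ⊔ ℓ₁ ⊔ ℓ₂)) where
  infixl 7 _*_
  infixl 6 _+_
  infix 4 _≈_ _≤_
  field
    Carrier : Set c
    _≈_     : Rel Carrier ℓ₁
    _≤_     : Rel Carrier ℓ₂
    _+_     : Carrier → Carrier → Carrier
    _*_     : Carrier → Carrier → Carrier
    -_      : Carrier → Carrier
    0#      : Carrier
    1#      : Carrier
    isCommutativeRing : IsCommutativeRing _≈_ _+_ _*_ -_ 0# 1#
    isTotalOrder      : IsTotalOrder _≈_ _≤_
    +-mono-≤  : ∀ {x y} z → x ≤ y → x + z ≤ y + z
    *-nonneg  : ∀ {x y} → 0# ≤ x → 0# ≤ y → 0# ≤ x * y
    0≉1       : ¬ (0# ≈ 1#)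
    inverse   : ∀ x → ¬ (x ≈ 0#) → ∃ λ y → x * y ≈ 1#
    sqrt      : ∀ x → 0# ≤ x → ∃ λ y → y * y ≈ x
    -- every monic polynomial of odd degree 2m+1 has a root;
    -- as : coefficients a₀ … a₂ₘ, polynomial a₀ + … + a₂ₘ x^{2m} + x^{2m+1}
    oddRoot   : ∀ (as : List Carrier) → (∃ λ m → length as ≡ m ℕ.+ m ℕ.+ 1) →
                ∃ λ x → horner _+_ _*_ 0# (as ++ [ 1# ]) x ≈ 0#

IsSimpleGraph : ∀ {n} → (Fin n → Fin n → Bool) → Set
IsSimpleGraph {n} adj =
  (∀ x y → adj x y ≡ adj y x) × (∀ x → adj x x ≡ false)

count : ∀ {n} → (Fin n → Bool) → ℕ
count {n} p = sum (map (λ z → if p z then 1 else 0) (allFin n))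

within : ∀ {n} → (Fin n → Fin n → Bool) → ℕ → Fin n → Fin n → Bool
within {n} adj zero    x y = does (x ≟ y)
within {n} adj (suc i) x y =
  within adj i x y ∨ any (λ z → within adj i x z ∧ adj z y) (allFin n)

distIs : ∀ {n} → (Fin n → Fin n → Bool) → Fin n → Fin n → ℕ → Bool
distIs adj x y zero    = within adj zero x y
distIs adj x y (suc i) = within adj (suc i) x y ∧ not (within adj i x y)

-- Γ is connected of diameter D and distance-regular with intersection
-- numbers b i, c i (c i only used for 1 ≤ i ≤ D).
record DistanceRegular {n} (adj : Fin n → Fin n → Bool)
                       (D : ℕ) (b c : ℕ → ℕ) : Set where
  field
    simple    : IsSimpleGraph adj
    connected : ∀ x y → ∃ λ i → i ℕ.≤ D × distIs adj x y i ≡ true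
    diameter  : ∃ λ x → ∃ λ y → distIs adj x y D ≡ true
    b-count   : ∀ x y i → distIs adj x y i ≡ true →
                count (λ z → adj y z ∧ distIs adj x z (suc i)) ≡ b i
    c-count   : ∀ x y i → distIs adj x y (suc i) ≡ true →
                count (λ z → adj y z ∧ distIs adj x z i) ≡ c (suc i)

-- a₁ = k − b₁ − c₁ with k = b₀
a₁ : (b c : ℕ → ℕ) → ℕ
a₁ b c = b 0 ∸ b 1 ∸ c 1

module _ {c ℓ₁ ℓ₂} (F : RealClosedField c ℓ₁ ℓ₂) where
  open RealClosedField F

  sumF : ∀ {n} → (Fin n → Carrier) → Carrier
  sumF {n} f = foldr (λ z acc → f z + acc) 0# (allFin n)

  adjMatrix : ∀ {n} → (Fin n → Fin n → Bool) → Fin n → Fin n → Carrier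
  adjMatrix adj x y = if adj x y then 1# else 0#

  fromℕ : ℕ → Carrier
  fromℕ zero    = 0#
  fromℕ (suc m) = 1# + fromℕ m

  IsEigenvalue : ∀ {n} → (Fin n → Fin n → Bool) → Carrier → Set (c ⊔ ℓ₁)
  IsEigenvalue {n} adj θ =
    ∃ λ (v : Fin n → Carrier) → (∃ λ x → ¬ (v x ≈ 0#)) ×
      (∀ x → sumF (λ y → adjMatrix adj x y * v y) ≈ θ * v x)

Ktri : ∀ t → Fin 3 × Fin t → Fin 3 × Fin t → Bool
Ktri t (i , _) (j , _) = not (does (i ≟ j))

IsoKtri : ∀ {n} → (Fin n → Fin n → Bool) → ℕ → Set
IsoKtri {n} adj t =
  Σ (Fin n ⤖ (Fin 3 × Fin t)) λ σ →
    ∀ x y → adj x y ≡ Ktri t (Bijection.to σ x) (Bijection.to σ y)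

-- Let v be a θ-eigenvector with v x₀ ≠ 0. The sums s_j of v over the spheres around x₀ satisfy the
-- three-term recurrence of the intersection numbers; rescaled by c₁⋯c_j b_j⋯b_{D-1} they give a
-- sequence g with g₀ ≠ 0 such that z ↦ g (d(w, z)) is a θ-eigenvector for every vertex w.
-- For a θ-eigenvector f of a k-regular graph whose edges lie in a₁ triangles each, the sum of
-- (f x + f y + f z)² over the ordered triangles xyz equals 3 a₁ (k + 2θ) Σ f², which is ≤ 0 when
-- θ ≤ -k/2: so f sums to zero on every triangle. For the radial eigenvectors this gives
-- g₀ + 2 g₁ = 0, which rules out K₄ (it would force 3 g₁ = 0, hence g₀ = 0). An edge with two,
-- hence nonadjacent, common neighbours then gives 2 g₁ + g₂ = 0, and together these forbid a
-- triangle at distances 2, 1, 2 from a vertex. So vertices at distance two have the same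
-- neighbours, the diameter is 2, and non-adjacency is an equivalence relation; without K₄ it has
-- three classes, each the common neighbourhood of an edge and hence of size a₁.

module Submission where

open import Algebra.Bundles using (CommutativeRing)
import Algebra.Properties.Ring as RingProperties
import Algebra.Properties.Semiring.Sum as SemiringSum
import Algebra.Solver.Ring.NaturalCoefficients.Default as NaturalSolver
open import Data.Bool using (Bool; true; false; _∧_; _∨_; not; if_then_else_)
open import Data.Bool.ListAction using (any)
open import Data.Bool.Properties
  using (∧-conicalˡ; ∧-conicalʳ; ∧-comm; ∧-zeroʳ; ∧-idem; ∨-zeroʳ; T-≡)
open import Data.Empty using (⊥; ⊥-elim)
open import Data.Fin as Fin using (Fin; zero; suc; _≟_; toℕ; fromℕ<; cast; combine; punchOut)
import Data.Fin.Properties as Fin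
open import Data.Fin.Patterns using (0F; 1F; 2F)
open import Data.List using (allFin; map; tabulate)
open import Data.List.Membership.Propositional.Properties using (∈-allFin)
open import Data.List.Relation.Unary.Any as Any using (satisfied)
open import Data.List.Relation.Unary.Any.Properties using (any⁺; any⁻)
open import Data.Nat as ℕ using (ℕ; zero; suc; _∸_; z≤n; s≤s; _≡ᵇ_; _<ᵇ_)
import Data.Nat.Properties as ℕ
open import Data.Nat.ListAction using (sum)
open import Data.Nat.Solver using (module +-*-Solver)
open import Data.Product using (∃; _×_; _,_; proj₁; proj₂)
open import Data.Sum using (_⊎_; inj₁; inj₂)
open import Function using (_∘_; id)
open import Function.Bundles using (_⤖_; mk⤖; Equivalence)
open import Relation.Binary using (tri<; tri≈; tri>; IsTotalOrder)
open import Relation.Binary.PropositionalEquality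
  using (_≡_; _≢_; refl; sym; trans; cong; cong₂; subst; module ≡-Reasoning)
open import Relation.Nullary using (¬_; Dec; does; yes; no)
open import Relation.Nullary.Decidable using (_⊎-dec_; dec-true; dec-false)

open import Defs

module Counting where
  open import Data.Nat using (_+_; _≤_; _<_)

  𝟙 : Bool → ℕ
  𝟙 b = if b then 1 else 0

  countᶠ : ∀ {n} → (Fin n → Bool) → ℕ
  countᶠ {zero}  p = 0
  countᶠ {suc n} p = 𝟙 (p zero) + countᶠ (p ∘ suc)

  count≡countᶠ : ∀ {n} (p : Fin n → Bool) → count p ≡ countᶠ p
  count≡countᶠ = go id
    where
    go : ∀ {m n} (h : Fin m → Fin n) (p : Fin n → Bool) →
         sum (map (λ z → 𝟙 (p z)) (tabulate h)) ≡ countᶠ (p ∘ h)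
    go {zero}  h p = refl
    go {suc m} h p = cong (𝟙 (p (h zero)) +_) (go (h ∘ suc) p)

  any-allFin⁺ : ∀ {n} (p : Fin n → Bool) z → p z ≡ true → any p (allFin n) ≡ true
  any-allFin⁺ p z pz =
    Equivalence.to T-≡ (any⁺ p (Any.map (λ { refl → Equivalence.from T-≡ pz }) (∈-allFin z)))

  any-allFin⁻ : ∀ {n} (p : Fin n → Bool) → any p (allFin n) ≡ true → ∃ λ z → p z ≡ true
  any-allFin⁻ {n} p h with z , pz ← satisfied (any⁻ p (allFin n) (Equivalence.from T-≡ h))
    = z , Equivalence.to T-≡ pz

  countᶠ-cong : ∀ {n} {p q : Fin n → Bool} → (∀ z → p z ≡ q z) → countᶠ p ≡ countᶠ q
  countᶠ-cong {zero}  e = refl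
  countᶠ-cong {suc n} e = cong₂ _+_ (cong 𝟙 (e zero)) (countᶠ-cong (e ∘ suc))

  countᶠ-const-false : ∀ {n} (p : Fin n → Bool) → (∀ z → p z ≡ false) → countᶠ p ≡ 0
  countᶠ-const-false {zero}  p h = refl
  countᶠ-const-false {suc n} p h rewrite h zero = countᶠ-const-false (p ∘ suc) (h ∘ suc)

  countᶠ-const-true : ∀ n → countᶠ {n} (λ _ → true) ≡ n
  countᶠ-const-true zero    = refl
  countᶠ-const-true (suc n) = cong suc (countᶠ-const-true n)

  countᶠ-≟ : ∀ {n} (w : Fin n) → countᶠ (λ u → does (u ≟ w)) ≡ 1
  countᶠ-≟ {suc n} zero    = cong suc (countᶠ-const-false {n} _ (λ _ → refl))
  countᶠ-≟ {suc n} (suc w) = countᶠ-≟ w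

  countᶠ-split : ∀ {n} (p q : Fin n → Bool) →
                 countᶠ p ≡ countᶠ (λ z → p z ∧ q z) + countᶠ (λ z → p z ∧ not (q z))
  countᶠ-split {zero}  p q = refl
  countᶠ-split {suc n} p q with p zero | q zero | countᶠ-split (p ∘ suc) (q ∘ suc)
  ... | false | _     | ih = ih
  ... | true  | true  | ih = cong suc ih
  ... | true  | false | ih = trans (cong suc ih) (sym (ℕ.+-suc _ _))

  countᶠ-partition₃ : ∀ {n} (p q₁ q₂ q₃ : Fin n → Bool) →
    (∀ z → p z ≡ true → 𝟙 (q₁ z) + 𝟙 (q₂ z) + 𝟙 (q₃ z) ≡ 1) →
    countᶠ p ≡ countᶠ (λ z → p z ∧ q₁ z) + countᶠ (λ z → p z ∧ q₂ z)
                                         + countᶠ (λ z → p z ∧ q₃ z)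
  countᶠ-partition₃ {zero} _ _ _ _ _ = refl
  countᶠ-partition₃ {suc n} p q₁ q₂ q₃ h with p zero in p₀
  ... | false = countᶠ-partition₃ (p ∘ suc) (q₁ ∘ suc) (q₂ ∘ suc) (q₃ ∘ suc) (h ∘ suc)
  ... | true = begin
    1 + countᶠ (p ∘ suc)                      ≡⟨ cong₂ _+_ (sym (h zero p₀)) partition-rest ⟩
    (x₁ + x₂ + x₃) + (c₁ + c₂ + c₃)          ≡⟨ solve 6 (λ x₁ x₂ x₃ c₁ c₂ c₃ →
                                                   (x₁ :+ x₂ :+ x₃) :+ (c₁ :+ c₂ :+ c₃) :=
                                                   (x₁ :+ c₁) :+ (x₂ :+ c₂) :+ (x₃ :+ c₃))
                                                 refl x₁ x₂ x₃ c₁ c₂ c₃ ⟩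
    (x₁ + c₁) + (x₂ + c₂) + (x₃ + c₃)        ∎
    where
    open ≡-Reasoning
    open +-*-Solver
    partition-rest = countᶠ-partition₃ (p ∘ suc) (q₁ ∘ suc) (q₂ ∘ suc) (q₃ ∘ suc) (h ∘ suc)
    x₁ = 𝟙 (q₁ zero)
    x₂ = 𝟙 (q₂ zero)
    x₃ = 𝟙 (q₃ zero)
    c₁ = countᶠ (λ z → p (suc z) ∧ q₁ (suc z))
    c₂ = countᶠ (λ z → p (suc z) ∧ q₂ (suc z))
    c₃ = countᶠ (λ z → p (suc z) ∧ q₃ (suc z))

  countᶠ-pos : ∀ {n} (p : Fin n → Bool) z → p z ≡ true → 1 ≤ countᶠ p
  countᶠ-pos p zero    e rewrite e = s≤s z≤n
  countᶠ-pos p (suc z) e = ℕ.≤-trans (countᶠ-pos (p ∘ suc) z e) (ℕ.m≤n+m _ _)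

  countᶠ-witness : ∀ {n} (p : Fin n → Bool) → 1 ≤ countᶠ p → ∃ λ z → p z ≡ true
  countᶠ-witness {suc n} p h with p zero in eq
  ... | true  = zero , eq
  ... | false with countᶠ-witness (p ∘ suc) h
  ...   | z , ez = suc z , ez

  private
    𝟙-mono : ∀ {a b} → (a ≡ true → b ≡ true) → 𝟙 a ≤ 𝟙 b
    𝟙-mono {false} h = z≤n
    𝟙-mono {true}  h rewrite h refl = ℕ.≤-refl

  countᶠ-mono : ∀ {n} {p q : Fin n → Bool} → (∀ z → p z ≡ true → q z ≡ true) →
                countᶠ p ≤ countᶠ q
  countᶠ-mono {zero}  h = z≤n
  countᶠ-mono {suc n} h = ℕ.+-mono-≤ (𝟙-mono (h zero)) (countᶠ-mono (h ∘ suc))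

  countᶠ-strict : ∀ {n} {p q : Fin n → Bool} → (∀ z → p z ≡ true → q z ≡ true) →
                  ∀ w → q w ≡ true → p w ≡ false → countᶠ p < countᶠ q
  countᶠ-strict {suc n} {p} h zero qw pw rewrite qw | pw = s≤s (countᶠ-mono (h ∘ suc))
  countᶠ-strict {suc n} h (suc w) qw pw =
    ℕ.+-mono-≤-< (𝟙-mono (h zero)) (countᶠ-strict (h ∘ suc) w qw pw)

  countᶠ-two-witnesses : ∀ {n} (p : Fin n → Bool) → 2 ≤ countᶠ p →
                         ∃ λ z → ∃ λ z′ → z ≢ z′ × p z ≡ true × p z′ ≡ true
  countᶠ-two-witnesses p h with countᶠ-witness p (ℕ.≤-trans (s≤s z≤n) h)
  ... | z , pz with countᶠ-witness (λ u → p u ∧ not (does (u ≟ z))) others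
    where
    atMostOne : countᶠ (λ u → p u ∧ does (u ≟ z)) ≤ 1
    atMostOne = ℕ.≤-trans (countᶠ-mono (λ u → ∧-conicalʳ (p u) _))
                          (ℕ.≤-reflexive (countᶠ-≟ z))
    others : 1 ≤ countᶠ (λ u → p u ∧ not (does (u ≟ z)))
    others = ℕ.+-cancelˡ-≤ 1 1 _ (begin
      2
        ≤⟨ h ⟩
      countᶠ p
        ≡⟨ countᶠ-split p (λ u → does (u ≟ z)) ⟩
      countᶠ (λ u → p u ∧ does (u ≟ z)) + countᶠ (λ u → p u ∧ not (does (u ≟ z)))
        ≤⟨ ℕ.+-monoˡ-≤ _ atMostOne ⟩
      1 + countᶠ (λ u → p u ∧ not (does (u ≟ z)))
        ∎)
      where open ℕ.≤-Reasoning
  ...   | z′ , pz′ = z , z′ , distinct , pz , ∧-conicalˡ _ _ pz′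
    where
    distinct : z ≢ z′
    distinct refl with () ← trans (cong not (sym (dec-true (z ≟ z) refl))) (∧-conicalʳ (p z) _ pz′)

open Counting

≡ᵇ-true⇒≡ : ∀ m n → (m ≡ᵇ n) ≡ true → m ≡ n
≡ᵇ-true⇒≡ m n e = ℕ.≡ᵇ⇒≡ m n (Equivalence.from T-≡ e)

≡⇒≡ᵇ-true : ∀ m n → m ≡ n → (m ≡ᵇ n) ≡ true
≡⇒≡ᵇ-true m n = dec-true (m ℕ.≟ n)

≢⇒≡ᵇ-false : ∀ {m n} → m ≢ n → (m ≡ᵇ n) ≡ false
≢⇒≡ᵇ-false {m} {n} = dec-false (m ℕ.≟ n)

≡ᵇ-refl : ∀ m → (m ≡ᵇ m) ≡ true
≡ᵇ-refl m = ≡⇒≡ᵇ-true m m refl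

≡ᵇ-suc : ∀ m → (m ≡ᵇ suc m) ≡ false
≡ᵇ-suc zero    = refl
≡ᵇ-suc (suc m) = ≡ᵇ-suc m

suc-≡ᵇ : ∀ m → (suc m ≡ᵇ m) ≡ false
suc-≡ᵇ zero    = refl
suc-≡ᵇ (suc m) = suc-≡ᵇ m

≡ᵇ-suc-suc : ∀ m → (m ≡ᵇ suc (suc m)) ≡ false
≡ᵇ-suc-suc zero    = refl
≡ᵇ-suc-suc (suc m) = ≡ᵇ-suc-suc m

suc-suc-≡ᵇ : ∀ m → (suc (suc m) ≡ᵇ m) ≡ false
suc-suc-≡ᵇ zero    = refl
suc-suc-≡ᵇ (suc m) = suc-suc-≡ᵇ m

∸-cancel : ∀ {k} x m y → k ≡ x ℕ.+ m ℕ.+ y → m ≡ k ∸ x ∸ y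
∸-cancel x m y refl = sym (begin
  x ℕ.+ m ℕ.+ y ∸ x ∸ y     ≡⟨ cong (_∸ y) (cong (_∸ x) (ℕ.+-assoc x m y)) ⟩
  x ℕ.+ (m ℕ.+ y) ∸ x ∸ y   ≡⟨ cong (_∸ y) (ℕ.m+n∸m≡n x (m ℕ.+ y)) ⟩
  m ℕ.+ y ∸ y               ≡⟨ ℕ.m+n∸n≡m m y ⟩
  m                         ∎)
  where open ≡-Reasoning

<ᵇ-irrefl : ∀ m → (m <ᵇ m) ≡ false
<ᵇ-irrefl zero    = refl
<ᵇ-irrefl (suc m) = <ᵇ-irrefl m

<ᵇ-true⇒< : ∀ {m n} → (m <ᵇ n) ≡ true → m ℕ.< n
<ᵇ-true⇒< {m} {n} e = ℕ.<ᵇ⇒< m n (Equivalence.from T-≡ e)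

<⇒<ᵇ-true : ∀ {m n} → m ℕ.< n → (m <ᵇ n) ≡ true
<⇒<ᵇ-true m<n = Equivalence.to T-≡ (ℕ.<⇒<ᵇ m<n)

cast-injective : ∀ {k l} (k≡l : k ≡ l) {i j : Fin k} → cast k≡l i ≡ cast k≡l j → i ≡ j
cast-injective k≡l {i} {j} e = begin
  i                          ≡⟨ Fin.cast-involutive (sym k≡l) k≡l i ⟨
  cast (sym k≡l) (cast k≡l i) ≡⟨ cong (cast (sym k≡l)) e ⟩
  cast (sym k≡l) (cast k≡l j) ≡⟨ Fin.cast-involutive (sym k≡l) k≡l j ⟩
  j                          ∎
  where open ≡-Reasoning

Near : ℕ → ℕ → Set
Near d e = e ≡ suc d ⊎ e ≡ d ⊎ suc e ≡ d

near? : ∀ d e → Dec (Near d e)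
near? d e = (e ℕ.≟ suc d) ⊎-dec ((e ℕ.≟ d) ⊎-dec (suc e ℕ.≟ d))

Near-sym : ∀ {d e} → Near d e → Near e d
Near-sym (inj₁ e≡1+d)        = inj₂ (inj₂ (sym e≡1+d))
Near-sym (inj₂ (inj₁ e≡d))   = inj₂ (inj₁ (sym e≡d))
Near-sym (inj₂ (inj₂ 1+e≡d)) = inj₁ (sym 1+e≡d)

close-trichotomy : ∀ {d e} → e ℕ.≤ suc d → d ℕ.≤ suc e → Near d e
close-trichotomy {d} {e} e≤1+d d≤1+e with ℕ.m≤n⇒m<n∨m≡n e≤1+d
... | inj₂ e≡1+d = inj₁ e≡1+d
... | inj₁ (s≤s e≤d) with ℕ.m≤n⇒m<n∨m≡n e≤d
...   | inj₂ e≡d = inj₂ (inj₁ e≡d)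
...   | inj₁ e<d = inj₂ (inj₂ (ℕ.≤-antisym e<d d≤1+e))

near-indicators : ∀ {d e} → Near d e →
                  𝟙 (e ≡ᵇ suc d) ℕ.+ 𝟙 (e ≡ᵇ d) ℕ.+ 𝟙 (suc e ≡ᵇ d) ≡ 1
near-indicators {d} (inj₁ refl) rewrite ≡ᵇ-refl d | suc-≡ᵇ d | suc-suc-≡ᵇ d = refl
near-indicators {d} (inj₂ (inj₁ refl)) rewrite ≡ᵇ-suc d | ≡ᵇ-refl d | suc-≡ᵇ d = refl
near-indicators {e = e} (inj₂ (inj₂ refl)) rewrite ≡ᵇ-suc-suc e | ≡ᵇ-suc e | ≡ᵇ-refl e = refl

module OrderedField {ℓ ℓ₁ ℓ₂} (F : RealClosedField ℓ ℓ₁ ℓ₂) where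
  open RealClosedField F public

  commutativeRing : CommutativeRing ℓ ℓ₁
  commutativeRing = record { isCommutativeRing = isCommutativeRing }

  open CommutativeRing commutativeRing public
    using ( setoid; +-cong; +-congˡ; +-congʳ; *-cong; *-congˡ; *-congʳ
          ; -‿cong; +-comm; *-assoc; *-comm; +-identityˡ; +-identityʳ
          ; *-identityˡ; distribˡ; distribʳ; -‿inverseˡ; -‿inverseʳ
          ; zeroˡ; zeroʳ; ring; semiring; commutativeSemiring )
    renaming (refl to ≈-refl; sym to ≈-sym; trans to ≈-trans)
  open RingProperties ring public using (-‿distribˡ-*; -‿distribʳ-*; -‿involutive)
  open SemiringSum semiring public
    using (sum-cong-≋; ∑-distrib-+; ∑-comm; *-distribˡ-sum; sum-replicate-zero)
    renaming (sum to ∑)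
  open import Algebra.Properties.Semiring.Mult semiring using (×1-homo-*) renaming (_×_ to _×ᵐ_)
  open NaturalSolver commutativeSemiring public using (solve; _:=_; _:+_; _:*_; con)
  open import Relation.Binary.Reasoning.Setoid setoid

  open IsTotalOrder isTotalOrder public
    using (total; antisym) renaming (refl to ≤-refl; trans to ≤-trans)

  ≤-resp-≈ : ∀ {a a′ b b′} → a ≈ a′ → b ≈ b′ → a ≤ b → a′ ≤ b′
  ≤-resp-≈ a≈a′ b≈b′ a≤b = IsTotalOrder.≲-respʳ-≈ isTotalOrder b≈b′
                              (IsTotalOrder.≲-respˡ-≈ isTotalOrder a≈a′ a≤b)

  nat : ℕ → Carrier
  nat = fromℕ F

  nat≡×1# : ∀ n → nat n ≡ n ×ᵐ 1#
  nat≡×1# zero    = refl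
  nat≡×1# (suc n) = cong (1# +_) (nat≡×1# n)

  nat-* : ∀ m n → nat (m ℕ.* n) ≈ nat m * nat n
  nat-* m n rewrite nat≡×1# (m ℕ.* n) | nat≡×1# m | nat≡×1# n = ×1-homo-* m n

  ≡⇒≈ : ∀ {a b} → a ≡ b → a ≈ b
  ≡⇒≈ refl = ≈-refl

  nat-*-≡ : ∀ m n p q → m ℕ.* n ≡ p ℕ.* q → nat m * nat n ≈ nat p * nat q
  nat-*-≡ m n p q e = ≈-trans (≈-sym (nat-* m n)) (≈-trans (≡⇒≈ (cong nat e)) (nat-* p q))

  exchange : ∀ {x y u w} z → x * y ≈ u * w → w * (u * z) ≈ x * (y * z)
  exchange {x} {y} {u} {w} z xy≈uw = begin
    w * (u * z)   ≈⟨ solve 3 (λ w u z → w :* (u :* z) := (u :* w) :* z) ≈-refl w u z ⟩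
    (u * w) * z   ≈⟨ *-congʳ xy≈uw ⟨
    (x * y) * z   ≈⟨ *-assoc x y z ⟩
    x * (y * z)   ∎

  -‿*-‿ : ∀ x y → - x * - y ≈ x * y
  -‿*-‿ x y = begin
    - x * - y     ≈⟨ -‿distribˡ-* x (- y) ⟨
    - (x * - y)   ≈⟨ -‿cong (-‿distribʳ-* x y) ⟨
    - - (x * y)   ≈⟨ -‿involutive (x * y) ⟩
    x * y         ∎

  +-monoʳ-≤ : ∀ z {x y} → x ≤ y → z + x ≤ z + y
  +-monoʳ-≤ z {x} {y} x≤y = ≤-resp-≈ (+-comm x z) (+-comm y z) (+-mono-≤ z x≤y)

  x≤0⇒0≤-x : ∀ {x} → x ≤ 0# → 0# ≤ - x
  x≤0⇒0≤-x {x} x≤0 = ≤-resp-≈ (-‿inverseʳ x) (+-identityˡ (- x)) (+-mono-≤ (- x) x≤0)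

  x≤0⇒x+y≤y : ∀ {x} y → x ≤ 0# → x + y ≤ y
  x≤0⇒x+y≤y y x≤0 = ≤-resp-≈ ≈-refl (+-identityˡ y) (+-mono-≤ y x≤0)

  x≤0⇒y≤0⇒x+y≤0 : ∀ {x y} → x ≤ 0# → y ≤ 0# → x + y ≤ 0#
  x≤0⇒y≤0⇒x+y≤0 hx hy = ≤-trans (x≤0⇒x+y≤y _ hx) hy

  0≤x⇒y≤0⇒x*y≤0 : ∀ {x y} → 0# ≤ x → y ≤ 0# → x * y ≤ 0#
  0≤x⇒y≤0⇒x*y≤0 {x} {y} hx hy =
    ≤-resp-≈ (+-identityˡ _) (-‿inverseˡ _) (+-mono-≤ (x * y) 0≤-xy)
    where
    0≤-xy : 0# ≤ - (x * y)
    0≤-xy = ≤-resp-≈ ≈-refl (≈-sym (-‿distribʳ-* x y)) (*-nonneg hx (x≤0⇒0≤-x hy))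

  x*x-nonneg : ∀ x → 0# ≤ x * x
  x*x-nonneg x with total 0# x
  ... | inj₁ 0≤x = *-nonneg 0≤x 0≤x
  ... | inj₂ x≤0 = ≤-resp-≈ ≈-refl (-‿*-‿ x x) (*-nonneg 0≤-x 0≤-x)
    where 0≤-x = x≤0⇒0≤-x x≤0

  0≤1 : 0# ≤ 1#
  0≤1 = ≤-resp-≈ ≈-refl (*-identityˡ 1#) (x*x-nonneg 1#)

  nat-nonneg : ∀ n → 0# ≤ nat n
  nat-nonneg zero    = ≤-refl
  nat-nonneg (suc n) = ≤-trans 0≤1 (≤-resp-≈ (+-identityʳ 1#) ≈-refl (+-monoʳ-≤ 1# (nat-nonneg n)))

  nat-suc≉0 : ∀ n → ¬ (nat (suc n) ≈ 0#)
  nat-suc≉0 n 1+n≈0 = 0≉1 (antisym 0≤1 (≤-resp-≈ ≈-refl 1+n≈0 1≤1+n))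
    where
    1≤1+n : 1# ≤ 1# + nat n
    1≤1+n = ≤-resp-≈ (+-identityʳ 1#) ≈-refl (+-monoʳ-≤ 1# (nat-nonneg n))

  *-≉0 : ∀ {x y} → ¬ (x ≈ 0#) → ¬ (y ≈ 0#) → ¬ (x * y ≈ 0#)
  *-≉0 {x} {y} x≉0 y≉0 xy≈0 with inverse x x≉0 | inverse y y≉0
  ... | x⁻¹ , xx⁻¹≈1 | y⁻¹ , yy⁻¹≈1 = 0≉1 (begin
    0#                    ≈⟨ zeroˡ (x⁻¹ * y⁻¹) ⟨
    0# * (x⁻¹ * y⁻¹)      ≈⟨ *-congʳ xy≈0 ⟨
    (x * y) * (x⁻¹ * y⁻¹) ≈⟨ solve 4 (λ a b c d → (a :* b) :* (c :* d) := (a :* c) :* (b :* d))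
                                     ≈-refl x y x⁻¹ y⁻¹ ⟩
    (x * x⁻¹) * (y * y⁻¹) ≈⟨ *-cong xx⁻¹≈1 yy⁻¹≈1 ⟩
    1# * 1#               ≈⟨ *-identityˡ 1# ⟩
    1#                    ∎)

  x+x+x≉0 : ∀ {x} → ¬ (x ≈ 0#) → ¬ (x + x + x ≈ 0#)
  x+x+x≉0 {x} x≉0 3x≈0 = *-≉0 (nat-suc≉0 2) x≉0 (≈-trans three-x 3x≈0)
    where
    three-x : nat 3 * x ≈ x + x + x
    three-x = solve 1 (λ x → (con 1 :+ (con 1 :+ (con 1 :+ con 0))) :* x := x :+ x :+ x) ≈-refl x

  +-≈0 : ∀ {x y} → x ≈ 0# → y ≈ 0# → x + y ≈ 0#
  +-≈0 x≈0 y≈0 = ≈-trans (+-cong x≈0 y≈0) (+-identityˡ 0#)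

  +-cancel-≈0 : ∀ {x y z} → x + y ≈ z → y ≈ 0# → z ≈ 0# → x ≈ 0#
  +-cancel-≈0 {x} {y} {z} x+y≈z y≈0 z≈0 = begin
    x       ≈⟨ +-identityʳ x ⟨
    x + 0#  ≈⟨ +-congˡ y≈0 ⟨
    x + y   ≈⟨ x+y≈z ⟩
    z       ≈⟨ z≈0 ⟩
    0#      ∎

  -- Equality in F is not decidable, so only the double negation is available.
  x*x≈0⇒¬¬x≈0 : ∀ {x} → x * x ≈ 0# → ¬ ¬ (x ≈ 0#)
  x*x≈0⇒¬¬x≈0 xx≈0 x≉0 = *-≉0 x≉0 x≉0 xx≈0

  sumF≡∑ : ∀ {n} (f : Fin n → Carrier) → sumF F f ≡ ∑ f
  sumF≡∑ = go id
    where
    go : ∀ {m n} (h : Fin m → Fin n) (f : Fin n → Carrier) →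
         Data.List.foldr (λ z acc → f z + acc) 0# (tabulate h) ≡ ∑ (f ∘ h)
    go {zero}  h f = refl
    go {suc m} h f = cong (f (h zero) +_) (go (h ∘ suc) f)

  ∑-zero : ∀ n → ∑ {n} (λ _ → 0#) ≈ 0#
  ∑-zero = sum-replicate-zero

  ∑-nonneg : ∀ {n} (f : Fin n → Carrier) → (∀ z → 0# ≤ f z) → 0# ≤ ∑ f
  ∑-nonneg {zero}  f h = ≤-refl
  ∑-nonneg {suc n} f h =
    ≤-trans (∑-nonneg (f ∘ suc) (h ∘ suc))
            (≤-resp-≈ (+-identityˡ _) ≈-refl (+-mono-≤ (∑ (f ∘ suc)) (h zero)))

  ∑-nonneg-≈0 : ∀ {n} (f : Fin n → Carrier) → (∀ z → 0# ≤ f z) → ∑ f ≈ 0# →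
                ∀ z → f z ≈ 0#
  ∑-nonneg-≈0 {suc n} f h ∑f≈0 = pointwise
    where
    rest = ∑ (f ∘ suc)
    0≤rest : 0# ≤ rest
    0≤rest = ∑-nonneg (f ∘ suc) (h ∘ suc)
    head≤0 : f zero ≤ 0#
    head≤0 = ≤-resp-≈ (+-identityʳ (f zero)) ∑f≈0 (+-monoʳ-≤ (f zero) 0≤rest)
    rest≤0 : rest ≤ 0#
    rest≤0 = ≤-resp-≈ (+-identityˡ _) ∑f≈0 (+-mono-≤ rest (h zero))
    pointwise : ∀ z → f z ≈ 0#
    pointwise zero    = antisym head≤0 (h zero)
    pointwise (suc z) = ∑-nonneg-≈0 (f ∘ suc) (h ∘ suc) (antisym rest≤0 0≤rest) z

  ∑-cong : ∀ {n} {f g : Fin n → Carrier} → (∀ z → f z ≈ g z) → ∑ f ≈ ∑ g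
  ∑-cong = sum-cong-≋

  ∑-distrib-+₃ : ∀ {n} (f g h : Fin n → Carrier) →
                 ∑ (λ z → f z + g z + h z) ≈ ∑ f + ∑ g + ∑ h
  ∑-distrib-+₃ f g h = ≈-trans (∑-distrib-+ _ h) (+-congʳ (∑-distrib-+ f g))

  ∑-*ˡ : ∀ {n} x (f : Fin n → Carrier) → ∑ (λ z → x * f z) ≈ x * ∑ f
  ∑-*ˡ x f = ≈-sym (*-distribˡ-sum x f)


  infixr 8 [_]*_

  [_]*_ : Bool → Carrier → Carrier
  [ p ]* x = if p then x else 0#

  []*-cong : ∀ p {x y} → x ≈ y → [ p ]* x ≈ [ p ]* y
  []*-cong true  x≈y = x≈y
  []*-cong false _   = ≈-refl

  *-[]* : ∀ p x y → x * [ p ]* y ≈ [ p ]* (x * y)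
  *-[]* true  x y = ≈-refl
  *-[]* false x y = zeroʳ x

  []*-* : ∀ p x y → [ p ]* x * y ≈ [ p ]* (x * y)
  []*-* true  x y = ≈-refl
  []*-* false x y = zeroˡ y

  []*-+ : ∀ p x y → [ p ]* (x + y) ≈ [ p ]* x + [ p ]* y
  []*-+ true  x y = ≈-refl
  []*-+ false x y = ≈-sym (+-identityˡ 0#)

  []*-[]* : ∀ p q x → [ p ]* [ q ]* x ≡ [ p ∧ q ]* x
  []*-[]* true  q x = refl
  []*-[]* false q x = refl

  []*-∑ : ∀ {n} p (f : Fin n → Carrier) → [ p ]* ∑ f ≈ ∑ (λ z → [ p ]* f z)
  []*-∑     true  f = ≈-refl
  []*-∑ {n} false f = ≈-sym (∑-zero n)

  ∑-[]*-const : ∀ {n} (p : Fin n → Bool) x → ∑ (λ z → [ p z ]* x) ≈ nat (countᶠ p) * x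
  ∑-[]*-const {zero}  p x = ≈-sym (zeroˡ x)
  ∑-[]*-const {suc n} p x with p zero
  ... | true  = begin
    x + ∑ (λ z → [ p (suc z) ]* x)
      ≈⟨ +-cong (≈-sym (*-identityˡ x)) (∑-[]*-const (p ∘ suc) x) ⟩
    1# * x + nat (countᶠ (p ∘ suc)) * x
      ≈⟨ distribʳ x 1# _ ⟨
    (1# + nat (countᶠ (p ∘ suc))) * x ∎
  ... | false = ≈-trans (+-identityˡ _) (∑-[]*-const (p ∘ suc) x)

  ∑-[]*-*ˡ : ∀ {n} (p : Fin n → Bool) x (f : Fin n → Carrier) →
             ∑ (λ z → [ p z ]* (x * f z)) ≈ x * ∑ (λ z → [ p z ]* f z)
  ∑-[]*-*ˡ p x f =
    ≈-trans (∑-cong (λ z → ≈-sym (*-[]* (p z) x (f z)))) (∑-*ˡ x (λ z → [ p z ]* f z))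

  levels : ℕ → ℕ → Carrier → Carrier → Carrier → Carrier
  levels d e X Y Z = [ e ≡ᵇ suc d ]* X + [ e ≡ᵇ d ]* Y + [ suc e ≡ᵇ d ]* Z

  levels-above : ∀ d X Y Z → levels d (suc d) X Y Z ≈ X
  levels-above d X Y Z rewrite ≡ᵇ-refl d | suc-≡ᵇ d | suc-suc-≡ᵇ d =
    ≈-trans (+-identityʳ _) (+-identityʳ X)

  levels-same : ∀ d X Y Z → levels d d X Y Z ≈ Y
  levels-same d X Y Z rewrite ≡ᵇ-suc d | ≡ᵇ-refl d | suc-≡ᵇ d =
    ≈-trans (+-identityʳ _) (+-identityˡ Y)

  levels-below : ∀ e X Y Z → levels (suc e) e X Y Z ≈ Z
  levels-below e X Y Z rewrite ≡ᵇ-suc-suc e | ≡ᵇ-suc e | ≡ᵇ-refl e =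
    ≈-trans (+-congʳ (+-identityˡ 0#)) (+-identityˡ Z)

  levels-far : ∀ {d e} → ¬ Near d e → ∀ X Y Z → levels d e X Y Z ≈ 0#
  levels-far {d} {e} ¬near X Y Z
    rewrite ≢⇒≡ᵇ-false {e} {suc d} (¬near ∘ inj₁)
          | ≢⇒≡ᵇ-false {e} {d} (¬near ∘ inj₂ ∘ inj₁)
          | ≢⇒≡ᵇ-false {suc e} {d} (¬near ∘ inj₂ ∘ inj₂)
    = ≈-trans (+-congʳ (+-identityˡ 0#)) (+-identityˡ 0#)

  levels-near : ∀ {d e} → Near d e → (h : ℕ → Carrier) →
                h e ≈ levels d e (h (suc d)) (h d) (h (d ∸ 1))
  levels-near {d} (inj₁ refl)        h = ≈-sym (levels-above d _ _ _)
  levels-near {d} (inj₂ (inj₁ refl)) h = ≈-sym (levels-same d _ _ _)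
  levels-near {e = e} (inj₂ (inj₂ refl)) h = ≈-sym (levels-below e _ _ _)

  []*-1#-* : ∀ p u → [ p ]* 1# * u ≈ [ p ]* u
  []*-1#-* true  u = *-identityˡ u
  []*-1#-* false u = zeroˡ u

  []*-levels : ∀ p d e X Y Z →
    [ p ]* levels d e X Y Z
    ≈ [ p ∧ (e ≡ᵇ suc d) ]* X + [ p ∧ (e ≡ᵇ d) ]* Y + [ p ∧ (suc e ≡ᵇ d) ]* Z
  []*-levels p d e X Y Z rewrite sym ([]*-[]* p (e ≡ᵇ suc d) X)
                               | sym ([]*-[]* p (e ≡ᵇ d) Y)
                               | sym ([]*-[]* p (suc e ≡ᵇ d) Z)
    = ≈-trans ([]*-+ p _ _) (+-congʳ ([]*-+ p _ _))

  levels-*ʳ : ∀ d e X Y Z u → levels d e X Y Z * u ≈ levels d e (X * u) (Y * u) (Z * u)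
  levels-*ʳ d e X Y Z u = begin
    ([ e ≡ᵇ suc d ]* X + [ e ≡ᵇ d ]* Y + [ suc e ≡ᵇ d ]* Z) * u
      ≈⟨ ≈-trans (distribʳ u _ _) (+-congʳ (distribʳ u _ _)) ⟩
    [ e ≡ᵇ suc d ]* X * u + [ e ≡ᵇ d ]* Y * u + [ suc e ≡ᵇ d ]* Z * u
      ≈⟨ +-cong (+-cong ([]*-* (e ≡ᵇ suc d) X u) ([]*-* (e ≡ᵇ d) Y u)) ([]*-* (suc e ≡ᵇ d) Z u) ⟩
    levels d e (X * u) (Y * u) (Z * u) ∎

module Distance {n} (adj : Fin n → Fin n → Bool) (simple : IsSimpleGraph adj) (D : ℕ)
                (connected : ∀ x y → ∃ λ i → i ℕ.≤ D × distIs adj x y i ≡ true) where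
  open import Data.Nat using (_≤_; _<_)

  adj-sym : ∀ x y → adj x y ≡ adj y x
  adj-sym = proj₁ simple

  adj-irrefl : ∀ x → adj x x ≡ false
  adj-irrefl = proj₂ simple

  adj-symmetric : ∀ {x y} → adj x y ≡ true → adj y x ≡ true
  adj-symmetric {x} {y} xy = trans (adj-sym y x) xy

  nonadj-symmetric : ∀ {x y} → adj x y ≡ false → adj y x ≡ false
  nonadj-symmetric {x} {y} xy = trans (adj-sym y x) xy

  adj⇒≢ : ∀ {x y} → adj x y ≡ true → x ≢ y
  adj⇒≢ {x} xy refl with trans (sym xy) (adj-irrefl x)
  ... | ()

  within-suc : ∀ i {x y} → within adj i x y ≡ true → within adj (suc i) x y ≡ true
  within-suc i e rewrite e = refl

  within-mono : ∀ {i j x y} → i ≤ j → within adj i x y ≡ true → within adj j x y ≡ true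
  within-mono {j = zero}  z≤n e = e
  within-mono {j = suc j} i≤1+j e with ℕ.m≤n⇒m<n∨m≡n i≤1+j
  ... | inj₁ (s≤s i≤j) = within-suc j (within-mono i≤j e)
  ... | inj₂ refl      = e

  within-step : ∀ i x {y z} → within adj i x y ≡ true → adj y z ≡ true →
                within adj (suc i) x z ≡ true
  within-step i x {y} {z} xy yz =
    trans (cong (within adj i x z ∨_) (any-allFin⁺ _ y (cong₂ _∧_ xy yz))) (∨-zeroʳ _)

  within-suc⁻ : ∀ i {x y} → within adj (suc i) x y ≡ true →
                within adj i x y ≡ true ⊎ ∃ λ z → within adj i x z ≡ true × adj z y ≡ true
  within-suc⁻ i {x} {y} e with within adj i x y
  ... | true  = inj₁ refl
  ... | false with z , xzy ← any-allFin⁻ _ e = inj₂ (z , ∧-conicalˡ _ _ xzy , ∧-conicalʳ _ _ xzy)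

  within-zero⁻ : ∀ {x y} → within adj 0 x y ≡ true → x ≡ y
  within-zero⁻ {x} {y} e with x ≟ y | e
  ... | yes x≡y | _ = x≡y
  ... | no _    | ()

  within-one⁻ : ∀ {x y} → within adj 1 x y ≡ true → x ≡ y ⊎ adj x y ≡ true
  within-one⁻ {x} {y} e with within-suc⁻ 0 {x} {y} e
  ... | inj₁ xy = inj₁ (within-zero⁻ xy)
  ... | inj₂ (z , xz , zy) with within-zero⁻ {x} {z} xz
  ...   | refl = inj₂ zy

  within-one-nonadj : ∀ {x y} → x ≢ y → adj x y ≡ false → within adj 1 x y ≡ false
  within-one-nonadj {x} {y} x≢y ¬xy with within adj 1 x y in e
  ... | false = refl
  ... | true with within-one⁻ e
  ...   | inj₁ x≡y = ⊥-elim (x≢y x≡y)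
  ...   | inj₂ xy  with trans (sym xy) ¬xy
  ...     | ()

  distIs⇒within : ∀ i x y → distIs adj x y i ≡ true → within adj i x y ≡ true
  distIs⇒within zero    x y e = e
  distIs⇒within (suc i) x y e = ∧-conicalˡ _ (not (within adj i x y)) e

  distIs⇒¬within-pred : ∀ i x y → distIs adj x y (suc i) ≡ true → within adj i x y ≡ false
  distIs⇒¬within-pred i x y e with within adj i x y | ∧-conicalʳ (within adj (suc i) x y) _ e
  ... | false | _ = refl

  distIs-<-⊥ : ∀ {x y i j} → i < j → distIs adj x y i ≡ true → distIs adj x y j ≡ true → ⊥
  distIs-<-⊥ {x} {y} {i} {suc j} (s≤s i≤j) ei ej
    with trans (sym (within-mono i≤j (distIs⇒within i x y ei))) (distIs⇒¬within-pred j x y ej)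
  ... | ()

  distIs-unique : ∀ {x y i j} → distIs adj x y i ≡ true → distIs adj x y j ≡ true → i ≡ j
  distIs-unique {i = i} {j} ei ej with ℕ.<-cmp i j
  ... | tri< i<j _ _ = ⊥-elim (distIs-<-⊥ i<j ei ej)
  ... | tri≈ _ i≡j _ = i≡j
  ... | tri> _ _ j<i = ⊥-elim (distIs-<-⊥ j<i ej ei)

  dist : Fin n → Fin n → ℕ
  dist x y = proj₁ (connected x y)

  dist≤D : ∀ x y → dist x y ≤ D
  dist≤D x y = proj₁ (proj₂ (connected x y))

  distIs-dist : ∀ x y → distIs adj x y (dist x y) ≡ true
  distIs-dist x y = proj₂ (proj₂ (connected x y))

  distIs⇒dist : ∀ x y {j} → distIs adj x y j ≡ true → dist x y ≡ j
  distIs⇒dist x y = distIs-unique (distIs-dist x y)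

  dist⇒distIs : ∀ x y {j} → dist x y ≡ j → distIs adj x y j ≡ true
  dist⇒distIs x y refl = distIs-dist x y

  distIs≡dist≡ᵇ : ∀ x y j → distIs adj x y j ≡ (dist x y ≡ᵇ j)
  distIs≡dist≡ᵇ x y j with distIs adj x y j in e
  ... | true = sym (≡⇒≡ᵇ-true (dist x y) j (distIs⇒dist x y e))
  ... | false with dist x y ≡ᵇ j in e′
  ...   | false = refl
  ...   | true with trans (sym (dist⇒distIs x y (≡ᵇ-true⇒≡ (dist x y) j e′))) e
  ...     | ()

  within⇒dist≤ : ∀ j {x y} → within adj j x y ≡ true → dist x y ≤ j
  within⇒dist≤ j {x} {y} e with dist x y in d | distIs-dist x y
  ... | zero  | _  = z≤n
  ... | suc i | di with ℕ.≤-<-connex (suc i) j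
  ...   | inj₁ 1+i≤j = 1+i≤j
  ...   | inj₂ (s≤s j≤i) with trans (sym (within-mono j≤i e)) (distIs⇒¬within-pred i x y di)
  ...     | ()

  dist-self : ∀ x → dist x x ≡ 0
  dist-self x = distIs⇒dist x x (dec-true (x ≟ x) refl)

  dist≡0⇒≡ : ∀ {x y} → dist x y ≡ 0 → x ≡ y
  dist≡0⇒≡ {x} {y} d≡0 = within-zero⁻ (dist⇒distIs x y d≡0)

  dist-step : ∀ w {y z} → adj y z ≡ true → dist w z ≤ suc (dist w y)
  dist-step w {y} yz =
    within⇒dist≤ (suc (dist w y))
                 (within-step (dist w y) w (distIs⇒within (dist w y) w y (distIs-dist w y)) yz)

  adj⇒dist≡1 : ∀ {x y} → adj x y ≡ true → dist x y ≡ 1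
  adj⇒dist≡1 {x} {y} xy = distIs⇒dist x y (cong₂ _∧_ (within-step 0 x (dec-true (x ≟ x) refl) xy)
                                                      (cong not (dec-false (x ≟ y) (adj⇒≢ xy))))

  dist≡1⇒adj : ∀ {x y} → dist x y ≡ 1 → adj x y ≡ true
  dist≡1⇒adj {x} {y} d≡1 with within-one⁻ {x} {y} (distIs⇒within 1 x y (dist⇒distIs x y d≡1))
  ... | inj₂ xy  = xy
  ... | inj₁ refl with trans (sym d≡1) (dist-self x)
  ...   | ()

  dist≡2 : ∀ {x y z} → x ≢ y → adj x y ≡ false → adj x z ≡ true → adj z y ≡ true →
           dist x y ≡ 2
  dist≡2 {x} {y} {z} x≢y ¬xy xz zy =
    distIs⇒dist x y (cong₂ _∧_ (within-step 1 x (within-step 0 x (dec-true (x ≟ x) refl) xz) zy)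
                               (cong not (within-one-nonadj x≢y ¬xy)))

  dist-pred : ∀ w {y i} → dist w y ≡ suc i → ∃ λ z → dist w z ≡ i × adj z y ≡ true
  dist-pred w {y} {i} d≡1+i with within-suc⁻ i (distIs⇒within (suc i) w y (dist⇒distIs w y d≡1+i))
  ... | inj₁ wy with trans (sym wy) (distIs⇒¬within-pred i w y (dist⇒distIs w y d≡1+i))
  ...   | ()
  dist-pred w {y} {i} d≡1+i | inj₂ (z , wz , zy) =
    z , ℕ.≤-antisym (within⇒dist≤ i wz) (ℕ.≤-pred i≤1+wz) , zy
    where i≤1+wz = subst (_≤ suc (dist w z)) d≡1+i (dist-step w zy)

  dist-neighbour : ∀ w {y z} → adj y z ≡ true → Near (dist w y) (dist w z)
  dist-neighbour w yz = close-trichotomy (dist-step w yz) (dist-step w (adj-symmetric yz))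

  dist≡2⇒≢ : ∀ {x y} → dist x y ≡ 2 → x ≢ y
  dist≡2⇒≢ {x} d≡2 refl with trans (sym d≡2) (dist-self x)
  ... | ()

  dist≡2⇒nonadj : ∀ {x y} → dist x y ≡ 2 → adj x y ≡ false
  dist≡2⇒nonadj {x} {y} d≡2 with adj x y in xy
  ... | false = refl
  ... | true with trans (sym d≡2) (adj⇒dist≡1 xy)
  ...   | ()

  adj≡dist≡ᵇ1 : ∀ x y → adj x y ≡ (dist x y ≡ᵇ 1)
  adj≡dist≡ᵇ1 x y with adj x y in xy
  ... | true = sym (≡⇒≡ᵇ-true (dist x y) 1 (adj⇒dist≡1 xy))
  ... | false with dist x y ≡ᵇ 1 in d≡1
  ...   | false = refl
  ...   | true with trans (sym (dist≡1⇒adj (≡ᵇ-true⇒≡ (dist x y) 1 d≡1))) xy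
  ...     | ()

-- Intersection numbers as neighbour counts

module DistanceRegularCounts {n} {adj : Fin n → Fin n → Bool} {D : ℕ} {b c : ℕ → ℕ}
                             (DR : DistanceRegular adj D b c) where
  open DistanceRegular DR
  open Distance adj simple D connected public
  open import Data.Nat using (_+_; _*_; _≤_; _<_)

  a : ℕ → ℕ
  a i = b 0 ∸ b i ∸ c i

  neighboursAt : Fin n → Fin n → ℕ → ℕ
  neighboursAt w y j = countᶠ (λ z → adj y z ∧ (dist w z ≡ᵇ j))

  neighboursBelow : Fin n → Fin n → ℕ
  neighboursBelow w y = countᶠ (λ z → adj y z ∧ (suc (dist w z) ≡ᵇ dist w y))

  count≡neighboursAt : ∀ w y j → count (λ z → adj y z ∧ distIs adj w z j) ≡ neighboursAt w y j
  count≡neighboursAt w y j =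
    trans (count≡countᶠ (λ z → adj y z ∧ distIs adj w z j))
          (countᶠ-cong (λ z → cong (adj y z ∧_) (distIs≡dist≡ᵇ w z j)))

  neighboursAt-above : ∀ w y → neighboursAt w y (suc (dist w y)) ≡ b (dist w y)
  neighboursAt-above w y =
    trans (sym (count≡neighboursAt w y _)) (b-count w y (dist w y) (distIs-dist w y))

  neighboursAt-below : ∀ w y {i} → dist w y ≡ suc i → neighboursAt w y i ≡ c (suc i)
  neighboursAt-below w y {i} d≡1+i =
    trans (sym (count≡neighboursAt w y i)) (c-count w y i (dist⇒distIs w y d≡1+i))

  neighboursBelow-zero : ∀ w y → dist w y ≡ 0 → neighboursBelow w y ≡ 0
  neighboursBelow-zero w y d≡0 rewrite d≡0 = countᶠ-const-false _ (λ z → ∧-zeroʳ (adj y z))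

  neighboursBelow-suc : ∀ w y {i} → dist w y ≡ suc i → neighboursBelow w y ≡ c (suc i)
  neighboursBelow-suc w y d≡1+i rewrite d≡1+i = neighboursAt-below w y d≡1+i

  degree : ∀ y → countᶠ (adj y) ≡ b 0
  degree y = begin
    countᶠ (adj y)                      ≡⟨ countᶠ-cong (λ z → trans (sym (∧-idem (adj y z)))
                                                         (cong (adj y z ∧_) (adj≡dist≡ᵇ1 y z))) ⟩
    neighboursAt y y 1                  ≡⟨ cong (λ d → neighboursAt y y (suc d)) (dist-self y) ⟨
    neighboursAt y y (suc (dist y y))   ≡⟨ neighboursAt-above y y ⟩
    b (dist y y)                        ≡⟨ cong b (dist-self y) ⟩
    b 0                                 ∎
    where open ≡-Reasoning

  -- c₀ d is c d with c 0 := 0 (the record leaves c 0 unconstrained), and b₋ j is b (j - 1)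
  -- with b (-1) := 0.
  c₀ : ℕ → ℕ
  c₀ zero    = 0
  c₀ (suc i) = c (suc i)

  b₋ : ℕ → ℕ
  b₋ zero    = 0
  b₋ (suc i) = b i

  a≡b₀∸b∸c₀ : ∀ d → b 0 ∸ b d ∸ c₀ d ≡ a d
  a≡b₀∸b∸c₀ zero rewrite ℕ.n∸n≡0 (b 0) = sym (ℕ.0∸n≡0 (c 0))
  a≡b₀∸b∸c₀ (suc i) = refl

  neighboursBelow≡c₀ : ∀ w y → neighboursBelow w y ≡ c₀ (dist w y)
  neighboursBelow≡c₀ w y = by-level (dist w y) refl
    where
    by-level : ∀ d → dist w y ≡ d → neighboursBelow w y ≡ c₀ (dist w y)
    by-level zero    d≡0   = trans (neighboursBelow-zero w y d≡0) (cong c₀ (sym d≡0))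
    by-level (suc i) d≡1+i = trans (neighboursBelow-suc w y d≡1+i) (cong c₀ (sym d≡1+i))

  degree-by-levels : ∀ w y → b 0 ≡ b (dist w y) + neighboursAt w y (dist w y) + c₀ (dist w y)
  degree-by-levels w y = begin
    b 0
      ≡⟨ degree y ⟨
    countᶠ (adj y)
      ≡⟨ countᶠ-partition₃ (adj y) _ _ _ (λ z yz → near-indicators (dist-neighbour w yz)) ⟩
    neighboursAt w y (suc (dist w y)) + neighboursAt w y (dist w y) + neighboursBelow w y
      ≡⟨ cong₂ (λ m l → m + neighboursAt w y (dist w y) + l)
               (neighboursAt-above w y) (neighboursBelow≡c₀ w y) ⟩
    b (dist w y) + neighboursAt w y (dist w y) + c₀ (dist w y) ∎
    where open ≡-Reasoning

  neighboursAt-level : ∀ w y → neighboursAt w y (dist w y) ≡ a (dist w y)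
  neighboursAt-level w y =
    trans (∸-cancel (b (dist w y)) _ (c₀ (dist w y)) (degree-by-levels w y)) (a≡b₀∸b∸c₀ (dist w y))

  neighboursAt-far : ∀ w y {j} → ¬ Near (dist w y) j → neighboursAt w y j ≡ 0
  neighboursAt-far w y {j} ¬near = countᶠ-const-false _ not-at-j
    where
    not-at-j : ∀ z → (adj y z ∧ (dist w z ≡ᵇ j)) ≡ false
    not-at-j z with adj y z in yz
    ... | false = refl
    ... | true  = ≢⇒≡ᵇ-false {dist w z} {j} (λ { refl → ¬near (dist-neighbour w yz) })

  common-neighbours : ∀ {x y} → adj x y ≡ true → countᶠ (λ z → adj y z ∧ adj x z) ≡ a 1
  common-neighbours {x} {y} xy = begin
    countᶠ (λ z → adj y z ∧ adj x z)
      ≡⟨ countᶠ-cong (λ z → cong (adj y z ∧_) (adj≡dist≡ᵇ1 x z)) ⟩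
    neighboursAt x y 1
      ≡⟨ cong (neighboursAt x y) (adj⇒dist≡1 xy) ⟨
    neighboursAt x y (dist x y)
      ≡⟨ neighboursAt-level x y ⟩
    a (dist x y)
      ≡⟨ cong a (adj⇒dist≡1 xy) ⟩
    a 1 ∎
    where open ≡-Reasoning

  b-pos : ∀ {m} → m < D → 1 ≤ b m
  b-pos {m} m<D with p , q , pq ← diameter = descend (distIs⇒dist p q pq) m<D
    where
    descend : ∀ {r y} → dist p y ≡ r → m < r → 1 ≤ b m
    descend {suc r} {y} py≡1+r (s≤s m≤r) with dist-pred p py≡1+r | ℕ.m≤n⇒m<n∨m≡n m≤r
    ... | z , pz≡r , zy | inj₁ m<r = descend pz≡r m<r
    ... | z , pz≡m , zy | inj₂ refl = begin
      1                                 ≤⟨ countᶠ-pos _ y (cong₂ _∧_ zy y-above-z) ⟩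
      neighboursAt p z (suc (dist p z)) ≡⟨ neighboursAt-above p z ⟩
      b (dist p z)                      ≡⟨ cong b pz≡m ⟩
      b m                               ∎
      where
      open ℕ.≤-Reasoning
      y-above-z : (dist p y ≡ᵇ suc (dist p z)) ≡ true
      y-above-z = ≡⇒≡ᵇ-true (dist p y) _ (trans py≡1+r (cong suc (sym pz≡m)))

  -- weight j = c₁ ⋯ c_j · b_j ⋯ b_{D-1}, chosen so that b_j · weight (j+1) = c_{j+1} · weight j.
  cproduct : ℕ → ℕ
  cproduct zero    = 1
  cproduct (suc j) = cproduct j * c (suc j)

  bproduct : ℕ → ℕ → ℕ
  bproduct j zero    = 1
  bproduct j (suc r) = b j * bproduct (suc j) r

  weight : ℕ → ℕ
  weight j = cproduct j * bproduct j (D ∸ j)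

  weight-step : ∀ {j} → j < D → b j * weight (suc j) ≡ c (suc j) * weight j
  weight-step {j} j<D rewrite ℕ.+-∸-assoc 1 j<D =
    solve 4 (λ bj C cj B → bj :* ((C :* cj) :* B) := cj :* (C :* (bj :* B)))
          refl (b j) (cproduct j) (c (suc j)) (bproduct (suc j) (D ∸ suc j))
    where open +-*-Solver

  bproduct-pos : ∀ j r → j ℕ.+ r ≤ D → 1 ≤ bproduct j r
  bproduct-pos j zero    _ = ℕ.≤-refl
  bproduct-pos j (suc r) j+1+r≤D =
    ℕ.*-mono-≤ (b-pos (ℕ.≤-trans (ℕ.m<m+n j (s≤s z≤n)) j+1+r≤D))
               (bproduct-pos (suc j) r (subst (_≤ D) (ℕ.+-suc j r) j+1+r≤D))

  weight-zero-pos : 1 ≤ weight 0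
  weight-zero-pos = subst (1 ≤_) (sym (ℕ.+-identityʳ _)) (bproduct-pos 0 D ℕ.≤-refl)

-- Radial eigenvectors of a distance-regular graph

IsEigenvector : ∀ {ℓ ℓ₁ ℓ₂} (F : RealClosedField ℓ ℓ₁ ℓ₂) {n} →
                (Fin n → Fin n → Bool) →
                RealClosedField.Carrier F → (Fin n → RealClosedField.Carrier F) → Set ℓ₁
IsEigenvector F adj θ v = ∀ x → ∑ (λ y → adjMatrix F adj x y * v y) ≈ θ * v x
  where open OrderedField F

module Radial {ℓ ℓ₁ ℓ₂} (F : RealClosedField ℓ ℓ₁ ℓ₂)
              {n} {adj : Fin n → Fin n → Bool} {D} {b c : ℕ → ℕ}
              (DR : DistanceRegular adj D b c) where
  open OrderedField F
  open DistanceRegularCounts DR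
  open import Relation.Binary.Reasoning.Setoid setoid

  RadialEquation : Carrier → (ℕ → Carrier) → ℕ → Set ℓ₁
  RadialEquation θ g d =
    θ * g d ≈ nat (b d) * g (suc d) + nat (a d) * g d + nat (c₀ d) * g (d ∸ 1)

  radial-eigenvector : ∀ {θ g} → (∀ d → d ℕ.≤ D → RadialEquation θ g d) →
                       ∀ w → IsEigenvector F adj θ (λ z → g (dist w z))
  radial-eigenvector {θ} {g} equation w y = begin
    ∑ (λ z → adjMatrix F adj y z * g (dist w z))
      ≈⟨ ∑-cong (λ z → ≈-trans (by-level z) ([]*-levels (adj y z) d (dist w z) _ _ _)) ⟩
    ∑ (λ z → [ above z ]* g (suc d) + [ same z ]* g d + [ below z ]* g (d ∸ 1))
      ≈⟨ ∑-distrib-+₃ (λ z → [ above z ]* g (suc d)) (λ z → [ same z ]* g d)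
                      (λ z → [ below z ]* g (d ∸ 1)) ⟩
    ∑ (λ z → [ above z ]* g (suc d)) + ∑ (λ z → [ same z ]* g d)
      + ∑ (λ z → [ below z ]* g (d ∸ 1))
      ≈⟨ +-cong (+-cong (∑-[]*-const above _) (∑-[]*-const same _)) (∑-[]*-const below _) ⟩
    nat (neighboursAt w y (suc d)) * g (suc d) + nat (neighboursAt w y d) * g d
      + nat (neighboursBelow w y) * g (d ∸ 1)
      ≈⟨ +-cong (+-cong (*-congʳ (≡⇒≈ (cong nat (neighboursAt-above w y))))
                        (*-congʳ (≡⇒≈ (cong nat (neighboursAt-level w y)))))
                (*-congʳ (≡⇒≈ (cong nat (neighboursBelow≡c₀ w y)))) ⟩
    nat (b d) * g (suc d) + nat (a d) * g d + nat (c₀ d) * g (d ∸ 1)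
      ≈⟨ equation d (dist≤D w y) ⟨
    θ * g d ∎
    where
    d = dist w y
    above same below : Fin n → Bool
    above z = adj y z ∧ (dist w z ≡ᵇ suc d)
    same  z = adj y z ∧ (dist w z ≡ᵇ d)
    below z = adj y z ∧ (suc (dist w z) ≡ᵇ d)
    by-level : ∀ z → adjMatrix F adj y z * g (dist w z)
                     ≈ [ adj y z ]* levels d (dist w z) (g (suc d)) (g d) (g (d ∸ 1))
    by-level z with adj y z in yz
    ... | true  = ≈-trans (*-identityˡ _) (levels-near (dist-neighbour w yz) g)
    ... | false = zeroˡ _

  neighboursAt-profile : ∀ w y j →
    nat (neighboursAt w y j) ≈ levels j (dist w y) (nat (c (suc j))) (nat (a j)) (nat (b₋ j))
  neighboursAt-profile w y j with near? j (dist w y)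
  ... | no ¬near = ≈-trans (≡⇒≈ (cong nat (neighboursAt-far w y (¬near ∘ Near-sym))))
                           (≈-sym (levels-far ¬near _ _ _))
  ... | yes (inj₁ d≡1+j) = ≈-trans (≡⇒≈ (cong nat (neighboursAt-below w y d≡1+j)))
    (≈-sym (subst (λ e → levels j e (nat (c (suc j))) (nat (a j)) (nat (b₋ j)) ≈ nat (c (suc j)))
                  (sym d≡1+j) (levels-above j _ _ _)))
  ... | yes (inj₂ (inj₁ refl)) = ≈-trans (≡⇒≈ (cong nat (neighboursAt-level w y)))
                                         (≈-sym (levels-same (dist w y) _ _ _))
  ... | yes (inj₂ (inj₂ refl)) = ≈-trans (≡⇒≈ (cong nat (neighboursAt-above w y)))
                                         (≈-sym (levels-below (dist w y) _ _ _))

  module RadialSums {θ v} (eigen : IsEigenvector F adj θ v) (x₀ : Fin n) where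

    s : ℕ → Carrier
    s j = ∑ (λ z → [ dist x₀ z ≡ᵇ j ]* v z)

    column : ∀ j z → ∑ (λ y → [ dist x₀ y ≡ᵇ j ]* (adjMatrix F adj y z * v z))
                     ≈ nat (neighboursAt x₀ z j) * v z
    column j z =
      ≈-trans (∑-cong pointwise) (∑-[]*-const (λ y → adj z y ∧ (dist x₀ y ≡ᵇ j)) (v z))
      where
      pointwise : ∀ y → [ dist x₀ y ≡ᵇ j ]* (adjMatrix F adj y z * v z)
                        ≈ [ adj z y ∧ (dist x₀ y ≡ᵇ j) ]* v z
      pointwise y = begin
        [ dist x₀ y ≡ᵇ j ]* (adjMatrix F adj y z * v z)
          ≈⟨ []*-cong (dist x₀ y ≡ᵇ j) ([]*-1#-* (adj y z) (v z)) ⟩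
        [ dist x₀ y ≡ᵇ j ]* [ adj y z ]* v z
          ≡⟨ []*-[]* (dist x₀ y ≡ᵇ j) (adj y z) (v z) ⟩
        [ (dist x₀ y ≡ᵇ j) ∧ adj y z ]* v z
          ≡⟨ cong (λ p → [ p ]* v z) (trans (∧-comm _ (adj y z)) (cong (_∧ _) (adj-sym y z))) ⟩
        [ adj z y ∧ (dist x₀ y ≡ᵇ j) ]* v z ∎

    shifted : ∀ j → nat (b₋ j) * ∑ (λ z → [ suc (dist x₀ z) ≡ᵇ j ]* v z)
                    ≈ nat (b₋ j) * s (j ∸ 1)
    shifted zero    = ≈-trans (zeroˡ _) (≈-sym (zeroˡ _))
    shifted (suc j) = ≈-refl

    s-recurrence : ∀ j → θ * s j ≈ nat (c (suc j)) * s (suc j) + nat (a j) * s j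
                                   + nat (b₋ j) * s (j ∸ 1)
    s-recurrence j = begin
      θ * s j
        ≈⟨ ∑-[]*-*ˡ (λ y → dist x₀ y ≡ᵇ j) θ v ⟨
      ∑ (λ y → [ dist x₀ y ≡ᵇ j ]* (θ * v y))
        ≈⟨ ∑-cong (λ y → []*-cong (dist x₀ y ≡ᵇ j) (≈-sym (eigen y))) ⟩
      ∑ (λ y → [ dist x₀ y ≡ᵇ j ]* ∑ (λ z → adjMatrix F adj y z * v z))
        ≈⟨ ∑-cong (λ y → []*-∑ (dist x₀ y ≡ᵇ j) (λ z → adjMatrix F adj y z * v z)) ⟩
      ∑ (λ y → ∑ (λ z → [ dist x₀ y ≡ᵇ j ]* (adjMatrix F adj y z * v z)))
        ≈⟨ ∑-comm (λ y z → [ dist x₀ y ≡ᵇ j ]* (adjMatrix F adj y z * v z)) ⟩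
      ∑ (λ z → ∑ (λ y → [ dist x₀ y ≡ᵇ j ]* (adjMatrix F adj y z * v z)))
        ≈⟨ ∑-cong (column j) ⟩
      ∑ (λ z → nat (neighboursAt x₀ z j) * v z)
        ≈⟨ ∑-cong (λ z → ≈-trans (*-congʳ (neighboursAt-profile x₀ z j))
                                 (levels-*ʳ j (dist x₀ z) _ _ _ (v z))) ⟩
      ∑ (λ z → levels j (dist x₀ z) (C * v z) (A * v z) (B * v z))
        ≈⟨ ∑-distrib-+₃ (λ z → [ above z ]* (C * v z)) (λ z → [ same z ]* (A * v z))
                        (λ z → [ below z ]* (B * v z)) ⟩
      ∑ (λ z → [ above z ]* (C * v z)) + ∑ (λ z → [ same z ]* (A * v z))
        + ∑ (λ z → [ below z ]* (B * v z))
        ≈⟨ +-cong (+-cong (∑-[]*-*ˡ above C v) (∑-[]*-*ˡ same A v))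
                  (≈-trans (∑-[]*-*ˡ below B v) (shifted j)) ⟩
      C * s (suc j) + A * s j + B * s (j ∸ 1) ∎
      where
      C = nat (c (suc j))
      A = nat (a j)
      B = nat (b₋ j)
      above same below : Fin n → Bool
      above z = dist x₀ z ≡ᵇ suc j
      same  z = dist x₀ z ≡ᵇ j
      below z = suc (dist x₀ z) ≡ᵇ j

    s-beyond : ∀ j → D ℕ.< j → s j ≈ 0#
    s-beyond j D<j = ≈-trans (∑-cong (λ z → ≡⇒≈ (cong ([_]* v z) (never z)))) (∑-zero n)
      where
      never : ∀ z → (dist x₀ z ≡ᵇ j) ≡ false
      never z = ≢⇒≡ᵇ-false {dist x₀ z} {j} (ℕ.<⇒≢ (ℕ.≤-<-trans (dist≤D x₀ z) D<j))

    s-zero : s 0 ≈ v x₀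
    s-zero = begin
      s 0                              ≈⟨ ∑-cong at-origin ⟩
      ∑ (λ z → [ is-x₀ z ]* v x₀)      ≈⟨ ∑-[]*-const is-x₀ (v x₀) ⟩
      nat (countᶠ is-x₀) * v x₀        ≈⟨ *-congʳ (≡⇒≈ (cong nat (countᶠ-≟ x₀))) ⟩
      (1# + 0#) * v x₀                 ≈⟨ *-congʳ (+-identityʳ 1#) ⟩
      1# * v x₀                        ≈⟨ *-identityˡ (v x₀) ⟩
      v x₀                             ∎
      where
      is-x₀ : Fin n → Bool
      is-x₀ z = does (z ≟ x₀)
      at-origin : ∀ z → [ dist x₀ z ≡ᵇ 0 ]* v z ≈ [ is-x₀ z ]* v x₀
      at-origin z with z ≟ x₀
      ... | yes refl = ≡⇒≈ (cong ([_]* v x₀) (≡⇒≡ᵇ-true (dist x₀ x₀) 0 (dist-self x₀)))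
      ... | no z≢x₀  =
        ≡⇒≈ (cong ([_]* v z) (≢⇒≡ᵇ-false {dist x₀ z} {0} (z≢x₀ ∘ sym ∘ dist≡0⇒≡)))

    g : ℕ → Carrier
    g j = nat (weight j) * s j

    g-zero≉0 : ¬ (v x₀ ≈ 0#) → ¬ (g 0 ≈ 0#)
    g-zero≉0 v₀≉0 with weight 0 | weight-zero-pos
    ... | suc w | _ = *-≉0 (nat-suc≉0 w) (λ s₀≈0 → v₀≉0 (≈-trans (≈-sym s-zero) s₀≈0))

    g-radial : ∀ d → d ℕ.≤ D → RadialEquation θ g d
    g-radial d d≤D = begin
      θ * (Q * s d)
        ≈⟨ solve 3 (λ t q x → t :* (q :* x) := q :* (t :* x)) ≈-refl θ Q (s d) ⟩
      Q * (θ * s d)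
        ≈⟨ *-congˡ (s-recurrence d) ⟩
      Q * (C * s (suc d) + A * s d + B * s (d ∸ 1))
        ≈⟨ ≈-trans (distribˡ Q _ _) (+-congʳ (distribˡ Q _ _)) ⟩
      Q * (C * s (suc d)) + Q * (A * s d) + Q * (B * s (d ∸ 1))
        ≈⟨ +-cong (+-cong (upper d≤D) (solve 3 (λ q a x → q :* (a :* x) := a :* (q :* x))
                                               ≈-refl Q A (s d)))
                  (lower d d≤D) ⟩
      nat (b d) * g (suc d) + A * g d + nat (c₀ d) * g (d ∸ 1) ∎
      where
      Q = nat (weight d)
      C = nat (c (suc d))
      A = nat (a d)
      B = nat (b₋ d)
      upper : d ℕ.≤ D → Q * (C * s (suc d)) ≈ nat (b d) * g (suc d)
      upper d≤D with ℕ.m≤n⇒m<n∨m≡n d≤D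
      ... | inj₁ d<D  = exchange (s (suc d)) (nat-*-≡ (b d) _ (c (suc d)) _ (weight-step d<D))
      ... | inj₂ refl = begin
        Q * (C * s (suc D))                      ≈⟨ *-congˡ (*-congˡ s-beyond-D) ⟩
        Q * (C * 0#)                             ≈⟨ ≈-trans (*-congˡ (zeroʳ C)) (zeroʳ Q) ⟩
        0#                                       ≈⟨ ≈-trans (*-congˡ (zeroʳ _)) (zeroʳ _) ⟨
        nat (b D) * (nat (weight (suc D)) * 0#)  ≈⟨ *-congˡ (*-congˡ s-beyond-D) ⟨
        nat (b D) * g (suc D)                    ∎
        where s-beyond-D = s-beyond (suc D) ℕ.≤-refl
      lower : ∀ d → d ℕ.≤ D →
              nat (weight d) * (nat (b₋ d) * s (d ∸ 1)) ≈ nat (c₀ d) * g (d ∸ 1)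
      lower zero    _   = ≈-trans (*-congˡ (zeroˡ _)) (≈-trans (zeroʳ _) (≈-sym (zeroˡ _)))
      lower (suc i) i<D = exchange (s i) (≈-sym (nat-*-≡ (b i) _ (c (suc i)) _ (weight-step i<D)))

-- Triangle sums of an eigenvector of an edge-regular graph

module TriangleSums {ℓ ℓ₁ ℓ₂} (F : RealClosedField ℓ ℓ₁ ℓ₂)
         {n} (adj : Fin n → Fin n → Bool) (adj-sym : ∀ x y → adj x y ≡ adj y x)
         (k t : ℕ) (regular : ∀ x → countᶠ (adj x) ≡ k)
         (edge-regular : ∀ {x y} → adj x y ≡ true → countᶠ (λ z → adj y z ∧ adj x z) ≡ t) where
  open OrderedField F
  open import Relation.Binary.Reasoning.Setoid setoid

  triangle : Fin n → Fin n → Fin n → Bool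
  triangle x y z = adj x y ∧ adj y z ∧ adj x z

  triangle-swap₁₂ : ∀ x y z → triangle y x z ≡ triangle x y z
  triangle-swap₁₂ x y z rewrite adj-sym y x with adj x y | adj y z | adj x z
  ... | false | _     | _     = refl
  ... | true  | true  | true  = refl
  ... | true  | true  | false = refl
  ... | true  | false | true  = refl
  ... | true  | false | false = refl

  triangle-swap₂₃ : ∀ x y z → triangle x z y ≡ triangle x y z
  triangle-swap₂₃ x y z rewrite adj-sym z y with adj x y | adj y z | adj x z
  ... | true  | true  | true  = refl
  ... | true  | true  | false = refl
  ... | true  | false | true  = refl
  ... | true  | false | false = refl
  ... | false | true  | true  = refl
  ... | false | true  | false = refl
  ... | false | false | true  = refl
  ... | false | false | false = refl

  Ternary : Set ℓ
  Ternary = Fin n → Fin n → Fin n → Carrier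

  on-triangles : Ternary → Ternary
  on-triangles H x y z = [ triangle x y z ]* H x y z

  ∑³ : Ternary → Carrier
  ∑³ H = ∑ (λ x → ∑ (λ y → ∑ (on-triangles H x y)))

  ∑³-cong : ∀ {H G : Ternary} → (∀ x y z → H x y z ≈ G x y z) → ∑³ H ≈ ∑³ G
  ∑³-cong H≈G =
    ∑-cong (λ x → ∑-cong (λ y → ∑-cong (λ z → []*-cong (triangle x y z) (H≈G x y z))))

  ∑³-+ : ∀ (H G : Ternary) → ∑³ (λ x y z → H x y z + G x y z) ≈ ∑³ H + ∑³ G
  ∑³-+ H G = begin
    ∑³ (λ x y z → H x y z + G x y z)
      ≈⟨ ∑-cong (λ x → ∑-cong (λ y → ≈-trans (∑-cong (λ z → []*-+ (triangle x y z) _ _))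
                                              (∑-distrib-+ (Ĥ x y) (Ĝ x y)))) ⟩
    ∑ (λ x → ∑ (λ y → ∑ (Ĥ x y) + ∑ (Ĝ x y)))
      ≈⟨ ∑-cong (λ x → ∑-distrib-+ (λ y → ∑ (Ĥ x y)) (λ y → ∑ (Ĝ x y))) ⟩
    ∑ (λ x → ∑ (λ y → ∑ (Ĥ x y)) + ∑ (λ y → ∑ (Ĝ x y)))
      ≈⟨ ∑-distrib-+ (λ x → ∑ (λ y → ∑ (Ĥ x y))) (λ x → ∑ (λ y → ∑ (Ĝ x y))) ⟩
    ∑³ H + ∑³ G ∎
    where
    Ĥ = on-triangles H
    Ĝ = on-triangles G

  ∑³-swap₁₂ : ∀ (H : Ternary) → ∑³ (λ x y z → H y x z) ≈ ∑³ H
  ∑³-swap₁₂ H = ≈-trans (∑-comm (λ x y → ∑ (λ z → [ triangle x y z ]* H y x z)))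
    (∑-cong λ x → ∑-cong λ y → ∑-cong λ z →
      ≡⇒≈ (cong ([_]* H x y z) (triangle-swap₁₂ x y z)))

  ∑³-swap₂₃ : ∀ (H : Ternary) → ∑³ (λ x y z → H x z y) ≈ ∑³ H
  ∑³-swap₂₃ H = ∑-cong λ x → ≈-trans (∑-comm (λ y z → [ triangle x y z ]* H x z y))
    (∑-cong λ y → ∑-cong λ z → ≡⇒≈ (cong ([_]* H x y z) (triangle-swap₂₃ x y z)))

  square-on-triangle-nonneg : ∀ (H : Ternary) x y z →
                              0# ≤ on-triangles (λ x y z → H x y z * H x y z) x y z
  square-on-triangle-nonneg H x y z with triangle x y z
  ... | true  = x*x-nonneg (H x y z)
  ... | false = ≤-refl

  ∑³-squares-nonneg : ∀ (H : Ternary) → 0# ≤ ∑³ (λ x y z → H x y z * H x y z)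
  ∑³-squares-nonneg H =
    ∑-nonneg _ λ x → ∑-nonneg _ λ y → ∑-nonneg _ λ z → square-on-triangle-nonneg H x y z

  ∑³-squares-≈0 : ∀ (H : Ternary) → ∑³ (λ x y z → H x y z * H x y z) ≈ 0# →
                  ∀ {x y z} → triangle x y z ≡ true → H x y z * H x y z ≈ 0#
  ∑³-squares-≈0 H ∑³≈0 {x} {y} {z} xyz = subst (λ p → [ p ]* (H x y z * H x y z) ≈ 0#) xyz
    (∑-nonneg-≈0 _ (nonneg x y)
      (∑-nonneg-≈0 _ (λ y → ∑-nonneg _ (nonneg x y))
        (∑-nonneg-≈0 _ (λ x → ∑-nonneg _ λ y → ∑-nonneg _ (nonneg x y)) ∑³≈0 x) y) z)
    where nonneg = square-on-triangle-nonneg H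

  triangles-on-edge : ∀ x y w → ∑ (λ z → [ triangle x y z ]* w) ≈ [ adj x y ]* (nat t * w)
  triangles-on-edge x y w with adj x y in xy
  ... | true  = ≈-trans (∑-[]*-const (λ z → adj y z ∧ adj x z) w)
                        (*-congʳ (≡⇒≈ (cong nat (edge-regular xy))))
  ... | false = ∑-zero n

  module _ {θ f} (eigen : IsEigenvector F adj θ f) where

    Σf² : Carrier
    Σf² = ∑ (λ x → f x * f x)

    ∑³-squares : ∑³ (λ x y z → f x * f x) ≈ nat k * nat t * Σf²
    ∑³-squares = begin
      ∑³ (λ x y z → f x * f x)
        ≈⟨ ∑-cong (λ x → ∑-cong (λ y → triangles-on-edge x y (f x * f x))) ⟩
      ∑ (λ x → ∑ (λ y → [ adj x y ]* (nat t * (f x * f x))))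
        ≈⟨ ∑-cong (λ x → ∑-[]*-const (adj x) (nat t * (f x * f x))) ⟩
      ∑ (λ x → nat (countᶠ (adj x)) * (nat t * (f x * f x)))
        ≈⟨ ∑-cong (λ x → ≈-trans (*-congʳ (≡⇒≈ (cong nat (regular x))))
                                 (≈-sym (*-assoc _ _ _))) ⟩
      ∑ (λ x → nat k * nat t * (f x * f x))
        ≈⟨ ∑-*ˡ (nat k * nat t) (λ x → f x * f x) ⟩
      nat k * nat t * Σf² ∎

    ∑³-neighbour-products : ∑³ (λ x y z → f y * f x) ≈ nat t * θ * Σf²
    ∑³-neighbour-products = begin
      ∑³ (λ x y z → f y * f x)
        ≈⟨ ∑-cong (λ x → ∑-cong (λ y → ≈-trans (triangles-on-edge x y (f y * f x))
                                                (edge-term x y))) ⟩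
      ∑ (λ x → ∑ (λ y → nat t * f x * (adjMatrix F adj x y * f y)))
        ≈⟨ ∑-cong (λ x → ∑-*ˡ (nat t * f x) (λ y → adjMatrix F adj x y * f y)) ⟩
      ∑ (λ x → nat t * f x * ∑ (λ y → adjMatrix F adj x y * f y))
        ≈⟨ ∑-cong (λ x → ≈-trans (*-congˡ (eigen x))
             (solve 3 (λ T th a → T :* a :* (th :* a) := T :* th :* (a :* a)) ≈-refl (nat t) θ (f x))) ⟩
      ∑ (λ x → nat t * θ * (f x * f x))
        ≈⟨ ∑-*ˡ (nat t * θ) (λ x → f x * f x) ⟩
      nat t * θ * Σf² ∎
      where
      edge-term : ∀ x y → [ adj x y ]* (nat t * (f y * f x))
                          ≈ nat t * f x * (adjMatrix F adj x y * f y)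
      edge-term x y = ≈-sym (begin
        nat t * f x * (adjMatrix F adj x y * f y) ≈⟨ *-congˡ ([]*-1#-* (adj x y) (f y)) ⟩
        nat t * f x * [ adj x y ]* f y            ≈⟨ *-[]* (adj x y) (nat t * f x) (f y) ⟩
        [ adj x y ]* (nat t * f x * f y)          ≈⟨ []*-cong (adj x y) (rearrange (nat t) (f x) (f y)) ⟩
        [ adj x y ]* (nat t * (f y * f x))        ∎)
        where rearrange = solve 3 (λ T a b → T :* a :* b := T :* (b :* a)) ≈-refl

    vertex-sum : Ternary
    vertex-sum x y z = f x + f y + f z

    vertex-share : Carrier
    vertex-share = nat t * (nat k + θ + θ) * Σf²

    ∑³-vertex-sum*first : ∑³ (λ x y z → vertex-sum x y z * f x) ≈ vertex-share
    ∑³-vertex-sum*first = begin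
      ∑³ (λ x y z → vertex-sum x y z * f x)
        ≈⟨ ∑³-cong (λ x y z → ≈-trans (distribʳ (f x) _ _) (+-congʳ (distribʳ (f x) _ _))) ⟩
      ∑³ (λ x y z → f x * f x + f y * f x + f z * f x)
        ≈⟨ ≈-trans (∑³-+ (λ x y z → f x * f x + f y * f x) (λ x y z → f z * f x))
                   (+-congʳ (∑³-+ (λ x y z → f x * f x) (λ x y z → f y * f x))) ⟩
      ∑³ (λ x y z → f x * f x) + ∑³ (λ x y z → f y * f x) + ∑³ (λ x y z → f z * f x)
        ≈⟨ +-cong (+-cong ∑³-squares ∑³-neighbour-products)
                  (≈-trans (∑³-swap₂₃ (λ x y z → f y * f x)) ∑³-neighbour-products) ⟩
      nat k * nat t * Σf² + nat t * θ * Σf² + nat t * θ * Σf²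
        ≈⟨ solve 4 (λ K T th S → K :* T :* S :+ T :* th :* S :+ T :* th :* S
                                 := T :* (K :+ th :+ th) :* S) ≈-refl (nat k) (nat t) θ Σf² ⟩
      nat t * (nat k + θ + θ) * Σf² ∎

    -- By the symmetry of triangles each vertex contributes the same amount.
    ∑³-vertex-sum² : ∑³ (λ x y z → vertex-sum x y z * vertex-sum x y z)
                     ≈ vertex-share + vertex-share + vertex-share
    ∑³-vertex-sum² = begin
      ∑³ (λ x y z → S x y z * S x y z)
        ≈⟨ ∑³-cong (λ x y z → ≈-trans (distribˡ (S x y z) _ _)
                                      (+-congʳ (distribˡ (S x y z) _ _))) ⟩
      ∑³ (λ x y z → S x y z * f x + S x y z * f y + S x y z * f z)
        ≈⟨ ≈-trans (∑³-+ (λ x y z → S x y z * f x + S x y z * f y) (λ x y z → S x y z * f z))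
                   (+-congʳ (∑³-+ (λ x y z → S x y z * f x) (λ x y z → S x y z * f y))) ⟩
      ∑³ (λ x y z → S x y z * f x) + ∑³ (λ x y z → S x y z * f y)
        + ∑³ (λ x y z → S x y z * f z)
        ≈⟨ +-cong (+-cong first (≈-trans second first)) (≈-trans third (≈-trans second first)) ⟩
      vertex-share + vertex-share + vertex-share ∎
      where
      S = vertex-sum
      first : ∑³ (λ x y z → S x y z * f x) ≈ vertex-share
      first = ∑³-vertex-sum*first
      second : ∑³ (λ x y z → S x y z * f y) ≈ ∑³ (λ x y z → S x y z * f x)
      second = ≈-trans (∑³-cong (λ x y z → *-congʳ (solve 3 (λ a b c → a :+ b :+ c := b :+ a :+ c)
                                                         ≈-refl (f x) (f y) (f z))))
                       (∑³-swap₁₂ (λ x y z → S x y z * f x))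
      third : ∑³ (λ x y z → S x y z * f z) ≈ ∑³ (λ x y z → S x y z * f y)
      third = ≈-trans (∑³-cong (λ x y z → *-congʳ (solve 3 (λ a b c → a :+ b :+ c := a :+ c :+ b)
                                                        ≈-refl (f x) (f y) (f z))))
                      (∑³-swap₂₃ (λ x y z → S x y z * f y))

    triangle-sums-vanish : θ * nat 2 ≤ - nat k →
                           ∀ {x y z} → triangle x y z ≡ true → ¬ ¬ (f x + f y + f z ≈ 0#)
    triangle-sums-vanish 2θ≤-k xyz = x*x≈0⇒¬¬x≈0
      (∑³-squares-≈0 vertex-sum (antisym ∑³≤0 (∑³-squares-nonneg vertex-sum)) xyz)
      where
      k+θ+θ≤0 : nat k + θ + θ ≤ 0#
      k+θ+θ≤0 = ≤-resp-≈ (solve 2 (λ th K → th :* (con 1 :+ (con 1 :+ con 0)) :+ K := K :+ th :+ th)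
                                  ≈-refl θ (nat k))
                         (-‿inverseˡ (nat k)) (+-mono-≤ (nat k) 2θ≤-k)
      vertex-share≤0 : vertex-share ≤ 0#
      vertex-share≤0 = ≤-resp-≈ (*-comm _ _) ≈-refl
              (0≤x⇒y≤0⇒x*y≤0 (∑-nonneg (λ x → f x * f x) (λ x → x*x-nonneg (f x)))
                             (0≤x⇒y≤0⇒x*y≤0 (nat-nonneg t) k+θ+θ≤0))
      ∑³≤0 : ∑³ (λ x y z → vertex-sum x y z * vertex-sum x y z) ≤ 0#
      ∑³≤0 = ≤-resp-≈ (≈-sym ∑³-vertex-sum²) ≈-refl
               (x≤0⇒y≤0⇒x+y≤0 (x≤0⇒y≤0⇒x+y≤0 vertex-share≤0 vertex-share≤0)
                              vertex-share≤0)

-- A partition of Fin n into m classes of size t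

injective⇒surjective : ∀ {m} (h : Fin m → Fin m) → (∀ x y → h x ≡ h y → x ≡ y) →
                       ∀ y → ∃ λ x → h x ≡ y
injective⇒surjective {suc m} h inj y with Fin.any? (λ x → h x ≟ y)
... | yes hit = hit
... | no miss = ⊥-elim (ℕ.<-irrefl refl (Fin.injective⇒≤ {f = avoid-y} avoid-y-injective))
  where
  y≢h : ∀ x → y ≢ h x
  y≢h x y≡hx = miss (x , sym y≡hx)
  avoid-y : Fin (suc m) → Fin m
  avoid-y x = punchOut (y≢h x)
  avoid-y-injective : ∀ {x x′} → avoid-y x ≡ avoid-y x′ → x ≡ x′
  avoid-y-injective {x} {x′} e = inj x x′ (Fin.punchOut-injective (y≢h x) (y≢h x′) e)

module ClassPartition {n m t : ℕ} (class : Fin n → Fin m)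
                      (class-size : ∀ j → countᶠ (λ u → does (class u ≟ j)) ≡ t)
                      (n≡m*t : n ≡ m ℕ.* t) where

  earlier : Fin n → Fin n → Bool
  earlier u z = does (class z ≟ class u) ∧ (toℕ z <ᵇ toℕ u)

  rank : Fin n → ℕ
  rank u = countᶠ (earlier u)

  earlier-irrefl : ∀ u → earlier u u ≡ false
  earlier-irrefl u rewrite dec-true (class u ≟ class u) refl = <ᵇ-irrefl (toℕ u)

  rank<t : ∀ u → rank u ℕ.< t
  rank<t u = subst (rank u ℕ.<_) (class-size (class u))
    (countᶠ-strict (λ z → ∧-conicalˡ _ _) u (dec-true (class u ≟ class u) refl)
                   (earlier-irrefl u))

  rank-mono : ∀ {u u′} → class u ≡ class u′ → toℕ u ℕ.< toℕ u′ → rank u ℕ.< rank u′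
  rank-mono {u} {u′} same u<u′ = countᶠ-strict earlier-trans u u-earlier (earlier-irrefl u)
    where
    earlier-trans : ∀ z → earlier u z ≡ true → earlier u′ z ≡ true
    earlier-trans z zu = cong₂ _∧_
      (subst (λ j → does (class z ≟ j) ≡ true) same (∧-conicalˡ _ _ zu))
      (<⇒<ᵇ-true (ℕ.<-trans (<ᵇ-true⇒< (∧-conicalʳ (does (class z ≟ class u)) _ zu)) u<u′))
    u-earlier : earlier u′ u ≡ true
    u-earlier = cong₂ _∧_ (dec-true (class u ≟ class u′) same)
                          (<⇒<ᵇ-true u<u′)

  encode : Fin n → Fin m × Fin t
  encode u = class u , fromℕ< (rank<t u)

  same-class-and-rank : ∀ {u u′} → class u ≡ class u′ → rank u ≡ rank u′ → u ≡ u′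
  same-class-and-rank {u} {u′} same same-rank with ℕ.<-cmp (toℕ u) (toℕ u′)
  ... | tri< u<u′ _ _ = ⊥-elim (ℕ.<-irrefl same-rank (rank-mono same u<u′))
  ... | tri≈ _ u≡u′ _ = Fin.toℕ-injective u≡u′
  ... | tri> _ _ u′<u = ⊥-elim (ℕ.<-irrefl (sym same-rank) (rank-mono (sym same) u′<u))

  encode-injective : ∀ u u′ → encode u ≡ encode u′ → u ≡ u′
  encode-injective u u′ e = same-class-and-rank (cong proj₁ e) (begin
    rank u                       ≡⟨ Fin.toℕ-fromℕ< (rank<t u) ⟨
    toℕ (proj₂ (encode u))       ≡⟨ cong (toℕ ∘ proj₂) e ⟩
    toℕ (proj₂ (encode u′))      ≡⟨ Fin.toℕ-fromℕ< (rank<t u′) ⟩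
    rank u′                      ∎)
    where open ≡-Reasoning

  embed : Fin m × Fin t → Fin n
  embed (j , r) = cast (sym n≡m*t) (combine j r)

  embed-injective : ∀ p q → embed p ≡ embed q → p ≡ q
  embed-injective (j , r) (j′ , r′) e
    with refl , refl ← Fin.combine-injective j r j′ r′ (cast-injective (sym n≡m*t) e)
    = refl

  embed∘encode-injective : ∀ x x′ → embed (encode x) ≡ embed (encode x′) → x ≡ x′
  embed∘encode-injective x x′ e = encode-injective x x′ (embed-injective (encode x) (encode x′) e)

  encode-surjective : ∀ p → ∃ λ u → encode u ≡ p
  encode-surjective p
    with u , e ← injective⇒surjective (embed ∘ encode) embed∘encode-injective (embed p)
    = u , embed-injective (encode u) p e

  bijection : Fin n ⤖ (Fin m × Fin t)
  bijection = mk⤖ {to = encode}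
    ( (λ {u} {u′} → encode-injective u u′)
    , λ p → proj₁ (encode-surjective p) , λ { refl → proj₂ (encode-surjective p) } )

-- Graphs carrying a triangle-balanced radial function

module Tripartite {ℓ ℓ₁ ℓ₂} (F : RealClosedField ℓ ℓ₁ ℓ₂) {n} (adj : Fin n → Fin n → Bool)
                  (simple : IsSimpleGraph adj) (D : ℕ)
                  (connected : ∀ x y → ∃ λ i → i ℕ.≤ D × distIs adj x y i ≡ true) where
  open OrderedField F
  open Distance adj simple D connected

  Balanced : (ℕ → Carrier) → Set ℓ₁
  Balanced g = ∀ w {x y z} → adj x y ≡ true → adj y z ≡ true → adj x z ≡ true →
               ¬ ¬ (g (dist w x) + g (dist w y) + g (dist w z) ≈ 0#)

  module _ {t} (edge-regular : ∀ {x y} → adj x y ≡ true → countᶠ (λ z → adj y z ∧ adj x z) ≡ t)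
           (2≤t : 2 ℕ.≤ t) {g} (g₀≉0 : ¬ (g 0 ≈ 0#)) (balanced : Balanced g) where

    balanced-at : ∀ w {x y z i j l} → dist w x ≡ i → dist w y ≡ j → dist w z ≡ l →
                  adj x y ≡ true → adj y z ≡ true → adj x z ≡ true → ¬ ¬ (g i + g j + g l ≈ 0#)
    balanced-at w refl refl refl = balanced w

    corner-sum : ∀ {x y z} → adj x y ≡ true → adj y z ≡ true → adj x z ≡ true →
                 ¬ ¬ (g 0 + g 1 + g 1 ≈ 0#)
    corner-sum {x} xy yz xz = balanced-at x (dist-self x) (adj⇒dist≡1 xy) (adj⇒dist≡1 xz) xy yz xz

    K₄-values-impossible : g 0 + g 1 + g 1 ≈ 0# → g 1 + g 1 + g 1 ≈ 0# → ⊥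
    K₄-values-impossible X Y =
      x+x+x≉0 g₀≉0 (+-cancel-≈0 combination (+-≈0 Y Y) (+-≈0 (+-≈0 X X) X))
      where
      R = g 0 + g 1 + g 1
      T = g 1 + g 1 + g 1
      combination : g 0 + g 0 + g 0 + (T + T) ≈ R + R + R
      combination = solve 2 (λ a b → a :+ a :+ a :+ ((b :+ b :+ b) :+ (b :+ b :+ b))
                                   := (a :+ b :+ b) :+ (a :+ b :+ b) :+ (a :+ b :+ b))
                            ≈-refl (g 0) (g 1)

    distance-two-values-impossible :
      g 0 + g 1 + g 1 ≈ 0# → g 1 + g 1 + g 2 ≈ 0# → g 2 + g 1 + g 2 ≈ 0# → ⊥
    distance-two-values-impossible X Y Z =
      x+x+x≉0 g₀≉0 (+-cancel-≈0 combination (+-≈0 (+-≈0 (+-≈0 Y Y) Y) Y)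
                                            (+-≈0 (+-≈0 Z Z) (+-≈0 (+-≈0 X X) X)))
      where
      P = g 1 + g 1 + g 2
      Q = g 2 + g 1 + g 2
      R = g 0 + g 1 + g 1
      -- 3 g₀ = 2 Q + 3 R − 4 P, with the subtraction moved to the left.
      combination : g 0 + g 0 + g 0 + (P + P + P + P) ≈ (Q + Q) + (R + R + R)
      combination = solve 3 (λ a b c → a :+ a :+ a
                                       :+ ((b :+ b :+ c) :+ (b :+ b :+ c) :+ (b :+ b :+ c) :+ (b :+ b :+ c))
                                     := ((c :+ b :+ c) :+ (c :+ b :+ c))
                                        :+ ((a :+ b :+ b) :+ (a :+ b :+ b) :+ (a :+ b :+ b)))
                            ≈-refl (g 0) (g 1) (g 2)

    no-K₄ : ∀ {p q r s} → adj p q ≡ true → adj p r ≡ true → adj p s ≡ true →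
            adj q r ≡ true → adj q s ≡ true → adj r s ≡ true → ⊥
    no-K₄ {s = s} pq pr ps qr qs rs = corner-sum pq qr pr λ X →
      balanced-at s (adj⇒dist≡1 (adj-symmetric ps)) (adj⇒dist≡1 (adj-symmetric qs))
                    (adj⇒dist≡1 (adj-symmetric rs)) pq qr pr λ Y →
      K₄-values-impossible X Y

    common-neighbours-two : ∀ {x y} → adj x y ≡ true → 2 ℕ.≤ countᶠ (λ z → adj y z ∧ adj x z)
    common-neighbours-two xy = subst (2 ℕ.≤_) (sym (edge-regular xy)) 2≤t

    common-neighbour : ∀ {x y} → adj x y ≡ true → ∃ λ z → adj y z ≡ true × adj x z ≡ true
    common-neighbour {x} {y} xy
      with z , yzxz ← countᶠ-witness (λ z → adj y z ∧ adj x z)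
                                     (ℕ.≤-trans (s≤s z≤n) (common-neighbours-two xy))
      = z , ∧-conicalˡ (adj y z) _ yzxz , ∧-conicalʳ (adj y z) _ yzxz

    module Diamond {x₀ y₀ z₀ z₁ : Fin n} (x₀y₀ : adj x₀ y₀ ≡ true)
                   (y₀z₀ : adj y₀ z₀ ≡ true) (x₀z₀ : adj x₀ z₀ ≡ true)
                   (y₀z₁ : adj y₀ z₁ ≡ true) (x₀z₁ : adj x₀ z₁ ≡ true)
                   (z₀≢z₁ : z₀ ≢ z₁) where

      ¬¬g₀+g₁+g₁≈0 : ¬ ¬ (g 0 + g 1 + g 1 ≈ 0#)
      ¬¬g₀+g₁+g₁≈0 = corner-sum x₀y₀ y₀z₀ x₀z₀

      -- z₀ and z₁ are not adjacent (no K₄), so z₁ sees the triangle x₀y₀z₀ at distances 1, 1, 2.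
      ¬¬g₁+g₁+g₂≈0 : ¬ ¬ (g 1 + g 1 + g 2 ≈ 0#)
      ¬¬g₁+g₁+g₂≈0 with adj z₁ z₀ in z₁z₀
      ... | true  = λ _ → no-K₄ x₀y₀ x₀z₀ x₀z₁ y₀z₀ y₀z₁ (adj-symmetric z₁z₀)
      ... | false = balanced-at z₁ (adj⇒dist≡1 (adj-symmetric x₀z₁))
                                   (adj⇒dist≡1 (adj-symmetric y₀z₁))
                                   (dist≡2 (z₀≢z₁ ∘ sym) z₁z₀ (adj-symmetric x₀z₁) x₀z₀)
                                   x₀y₀ y₀z₀ x₀z₀

      shared-neighbour : ∀ {x y a p} → x ≢ y → adj x y ≡ false →
                         adj x a ≡ true → adj a y ≡ true →
                         adj x p ≡ true → adj a p ≡ true → adj p y ≡ true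
      shared-neighbour {x} {y} {a} {p} x≢y ¬xy xa ay xp ap with adj p y in py
      ... | true  = refl
      ... | false = ⊥-elim (¬¬g₀+g₁+g₁≈0 λ X → ¬¬g₁+g₁+g₂≈0 λ Y →
                      balanced-at y yx≡2 (adj⇒dist≡1 (adj-symmetric ay)) yp≡2 xa ap xp λ Z →
                      distance-two-values-impossible X Y Z)
        where
        y≢p : y ≢ p
        y≢p refl with trans (sym xp) ¬xy
        ... | ()
        yx≡2 = dist≡2 (x≢y ∘ sym) (nonadj-symmetric ¬xy) (adj-symmetric ay) (adj-symmetric xa)
        yp≡2 = dist≡2 y≢p (nonadj-symmetric py) (adj-symmetric ay) ap

      distance-two-same-neighbours : ∀ {x y a} → x ≢ y → adj x y ≡ false →
                                     adj x a ≡ true → adj a y ≡ true →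
                                     ∀ {q} → adj x q ≡ true → adj y q ≡ true
      distance-two-same-neighbours {x} {y} {a} x≢y ¬xy xa ay {q} xq with q ≟ a
      ... | yes refl = adj-symmetric ay
      ... | no q≢a with adj a q in aq
      ...   | true  = adj-symmetric (shared-neighbour x≢y ¬xy xa ay xq aq)
      ...   | false with p , ap , xp ← common-neighbour xa
                      = adj-symmetric (shared-neighbour x≢y ¬xy xp py xq pq)
        where
        py : adj p y ≡ true
        py = shared-neighbour x≢y ¬xy xa ay xp ap
        pq : adj p q ≡ true
        pq = shared-neighbour (q≢a ∘ sym) aq (adj-symmetric xa) xq ap xp

      no-distance-three : ∀ d {x y} → dist x y ≡ 3 ℕ.+ d → ⊥
      no-distance-three (suc d) {x} xy≡ with _ , xz≡ , _ ← dist-pred x xy≡ = no-distance-three d xz≡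
      no-distance-three zero {x} {y} xy≡3
        with z , xz≡2 , zy ← dist-pred x xy≡3
        with a , xa≡1 , az ← dist-pred x xz≡2
        with trans (sym xy≡3) (adj⇒dist≡1
               (distance-two-same-neighbours (dist≡2⇒≢ xz≡2 ∘ sym)
                                             (nonadj-symmetric (dist≡2⇒nonadj xz≡2))
                                             (adj-symmetric az) (adj-symmetric (dist≡1⇒adj xa≡1)) zy))
      ... | ()

      nonadjacent-same-neighbours : ∀ {x y} → x ≢ y → adj x y ≡ false →
                                    ∀ {q} → adj x q ≡ true → adj y q ≡ true
      nonadjacent-same-neighbours {x} {y} x≢y ¬xy with dist x y in xy≡
      ... | zero = ⊥-elim (x≢y (dist≡0⇒≡ xy≡))
      ... | suc zero with trans (sym (dist≡1⇒adj xy≡)) ¬xy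
      ...   | ()
      nonadjacent-same-neighbours {x} {y} x≢y ¬xy | suc (suc zero)
        with a , xa≡1 , ay ← dist-pred x xy≡
        = distance-two-same-neighbours x≢y ¬xy (dist≡1⇒adj xa≡1) ay
      nonadjacent-same-neighbours {x} {y} x≢y ¬xy | suc (suc (suc d)) =
        ⊥-elim (no-distance-three d xy≡)

      nonadjacent⇒neighbour : ∀ {u r q} → adj u r ≡ false → adj r q ≡ true → adj u q ≡ true
      nonadjacent⇒neighbour {u} {r} ¬ur rq with r ≟ u
      ... | yes refl = rq
      ... | no r≢u   = nonadjacent-same-neighbours r≢u (nonadj-symmetric ¬ur) rq

      class : Fin n → Fin 3
      class u = if adj u x₀ then (if adj u y₀ then 2F else 1F) else 0F

      representative : Fin 3 → Fin n
      representative 0F = x₀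
      representative 1F = y₀
      representative 2F = z₀

      adj-representative : ∀ u j → adj u (representative j) ≡ not (does (class u ≟ j))
      adj-representative u 0F with adj u x₀
      ... | false = refl
      ... | true with adj u y₀
      ...   | false = refl
      ...   | true  = refl
      adj-representative u 1F with adj u x₀ in ux₀
      ... | false = nonadjacent⇒neighbour ux₀ x₀y₀
      ... | true with adj u y₀
      ...   | false = refl
      ...   | true  = refl
      adj-representative u 2F with adj u x₀ in ux₀
      ... | false = nonadjacent⇒neighbour ux₀ x₀z₀
      ... | true with adj u y₀ in uy₀
      ...   | false = nonadjacent⇒neighbour uy₀ y₀z₀
      ...   | true with adj u z₀ in uz₀
      ...     | false = refl
      ...     | true  = ⊥-elim (no-K₄ ux₀ uy₀ uz₀ x₀y₀ x₀z₀ y₀z₀)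

      nonadjacent-to-own-representative : ∀ u → adj u (representative (class u)) ≡ false
      nonadjacent-to-own-representative u =
        trans (adj-representative u (class u)) (cong not (dec-true (class u ≟ class u) refl))

      same-class-nonadjacent : ∀ {u u′} → class u ≡ class u′ → adj u u′ ≡ false
      same-class-nonadjacent {u} {u′} same with adj u u′ in uu′
      ... | false = refl
      ... | true with trans (sym (nonadjacent⇒neighbour (nonadj-symmetric ¬ur) uu′))
                            (nonadj-symmetric (nonadjacent-to-own-representative u′))
        where
        ¬ur : adj u (representative (class u′)) ≡ false
        ¬ur = subst (λ j → adj u (representative j) ≡ false) same (nonadjacent-to-own-representative u)
      ...   | ()

      different-class-adjacent : ∀ {u u′} → class u ≢ class u′ → adj u u′ ≡ true
      different-class-adjacent {u} {u′} differ =
        adj-symmetric (nonadjacent⇒neighbour (nonadjacent-to-own-representative u′) (adj-symmetric ur′))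
        where
        ur′ : adj u (representative (class u′)) ≡ true
        ur′ = trans (adj-representative u (class u′)) (cong not (dec-false (class u ≟ class u′) differ))

      adj-by-class : ∀ u u′ → adj u u′ ≡ not (does (class u ≟ class u′))
      adj-by-class u u′ with class u ≟ class u′
      ... | yes same  = same-class-nonadjacent same
      ... | no differ = different-class-adjacent differ

      class-is-common-neighbourhood : ∀ j k l → adj (representative k) (representative l) ≡ true →
        (∀ (i : Fin 3) → does (i ≟ j) ≡ not (does (i ≟ l)) ∧ not (does (i ≟ k))) →
        countᶠ (λ u → does (class u ≟ j)) ≡ t
      class-is-common-neighbourhood j k l kl by-others = trans (countᶠ-cong pointwise) (edge-regular kl)
        where
        pointwise : ∀ u → does (class u ≟ j) ≡ (adj (representative l) u ∧ adj (representative k) u)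
        pointwise u = trans (by-others (class u))
          (sym (cong₂ _∧_ (trans (adj-sym _ u) (adj-representative u l))
                          (trans (adj-sym _ u) (adj-representative u k))))

      class-size : ∀ j → countᶠ (λ u → does (class u ≟ j)) ≡ t
      class-size 0F = class-is-common-neighbourhood 0F 1F 2F y₀z₀ λ { 0F → refl; 1F → refl; 2F → refl }
      class-size 1F = class-is-common-neighbourhood 1F 0F 2F x₀z₀ λ { 0F → refl; 1F → refl; 2F → refl }
      class-size 2F = class-is-common-neighbourhood 2F 0F 1F x₀y₀ λ { 0F → refl; 1F → refl; 2F → refl }

      vertex-count : n ≡ 3 ℕ.* t
      vertex-count = begin
        n
          ≡⟨ countᶠ-const-true n ⟨
        countᶠ {n} (λ _ → true)
          ≡⟨ countᶠ-partition₃ (λ _ → true) (in-class 0F) (in-class 1F) (in-class 2F)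
                               (λ u _ → exactly-one (class u)) ⟩
        countᶠ (in-class 0F) ℕ.+ countᶠ (in-class 1F) ℕ.+ countᶠ (in-class 2F)
          ≡⟨ cong₂ ℕ._+_ (cong₂ ℕ._+_ (class-size 0F) (class-size 1F)) (class-size 2F) ⟩
        t ℕ.+ t ℕ.+ t
          ≡⟨ ℕ.+-assoc t t t ⟩
        t ℕ.+ (t ℕ.+ t)
          ≡⟨ cong (λ x → t ℕ.+ (t ℕ.+ x)) (ℕ.+-identityʳ t) ⟨
        3 ℕ.* t
          ∎
        where
        open ≡-Reasoning
        in-class : Fin 3 → Fin n → Bool
        in-class j u = does (class u ≟ j)
        exactly-one : ∀ (i : Fin 3) →
          𝟙 (does (i ≟ 0F)) ℕ.+ 𝟙 (does (i ≟ 1F)) ℕ.+ 𝟙 (does (i ≟ 2F)) ≡ 1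
        exactly-one 0F = refl
        exactly-one 1F = refl
        exactly-one 2F = refl

      complete-tripartite : ∃ λ t′ → 2 ℕ.≤ t′ × IsoKtri adj t′
      complete-tripartite = t , 2≤t , bijection , adj-by-class
        where open ClassPartition class class-size vertex-count

    complete-tripartite : ∀ {x₀ y₀} → adj x₀ y₀ ≡ true →
                          ∃ λ t′ → 2 ℕ.≤ t′ × IsoKtri adj t′
    complete-tripartite {x₀} {y₀} x₀y₀
      with z₀ , z₁ , z₀≢z₁ , z₀-common , z₁-common
             ← countᶠ-two-witnesses (λ z → adj y₀ z ∧ adj x₀ z) (common-neighbours-two x₀y₀)
      = Diamond.complete-tripartite x₀y₀
          (∧-conicalˡ (adj y₀ z₀) _ z₀-common) (∧-conicalʳ (adj y₀ z₀) _ z₀-common)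
          (∧-conicalˡ (adj y₀ z₁) _ z₁-common) (∧-conicalʳ (adj y₀ z₁) _ z₁-common) z₀≢z₁

open import Data.Nat using (_≤_)

lemma4p3 : ∀ {c ℓ₁ ℓ₂} (F : RealClosedField c ℓ₁ ℓ₂) →
    ∀ (n : ℕ) (adj : Fin n → Fin n → Bool) (D : ℕ) (b c : ℕ → ℕ) →
    DistanceRegular adj D b c →
    2 ≤ b 0 → 2 ≤ D →
    (∃ λ θ → IsEigenvalue F adj θ ×
      RealClosedField._≤_ F (RealClosedField._*_ F θ (fromℕ F 2))
                            (RealClosedField.-_ F (fromℕ F (b 0)))) →
    2 ≤ a₁ b c →
    ∃ λ t → 2 ≤ t × IsoKtri adj t
lemma4p3 F n adj D b c DR 2≤k _ (θ , (v , (x₀ , v₀≉0) , eigenvalue) , 2θ≤-k) 2≤a₁ =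
  complete-tripartite common-neighbours 2≤a₁ {g} (g-zero≉0 v₀≉0) balanced (proj₂ neighbour)
  where
  open OrderedField F
  open DistanceRegular DR using (simple; connected)
  open DistanceRegularCounts DR
  open Radial F DR
  open Tripartite F adj simple D connected

  neighbour : ∃ λ y₀ → adj x₀ y₀ ≡ true
  neighbour = countᶠ-witness (adj x₀)
                (ℕ.≤-trans (s≤s z≤n) (subst (2 ℕ.≤_) (sym (degree x₀)) 2≤k))

  eigenvector : IsEigenvector F adj θ v
  eigenvector x = subst (_≈ θ * v x) (sumF≡∑ (λ y → adjMatrix F adj x y * v y)) (eigenvalue x)

  open RadialSums eigenvector x₀
  open TriangleSums F adj adj-sym (b 0) (a 1) degree common-neighbours

  balanced : Balanced g
  balanced w xy yz xz = triangle-sums-vanish (radial-eigenvector {g = g} g-radial w) 2θ≤-k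
                                             (cong₂ _∧_ xy (cong₂ _∧_ yz xz))
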